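{- Let $r$ be a power of $2$. For each odd integer $n>0$ let $A_n\in t\,\mathbb{Z}/2[t^2]$, and suppose that for all odd $n>0$ \[ A_{n+8r}=t^{8r}A_n+t^{2r}A_{n+2r}. \] Say that $A_n$ satisfies condition $(1\alpha)$ if, writing $t^n=[a,b]$: when $a>0$, $A_n=[a-1,b]+$ a sum of monomials preceding $[a-1,b]$; when $a=0$, $A_n$ is a sum of monomials each equal to or preceding $[0,b-1]$. If $A_n$ satisfies $(1\alpha)$ for every odd $n<8r^2$, then $A_n$ satisfies $(1\alpha)$ for every odd $n>0$.
   Context: $\mathbb{N}=\{0,1,2,\dots\}$. Let $g:\mathbb{N}\to\mathbb{N}$ be defined by $g(0)=0$, $g(2n)=4g(n)$, $g(2n+1)=g(2n)+1$ (so if $n$ is a sum of distinct powers $q$ of $2$, $g(n)$ is the sum of the $q^2$). For $a,b\in\mathbb{N}$, $[a,b]$ denotes the monomial $t^{1+2g(a)+4g(b)}\in\mathbb{Z}/2[t]$; $(a,b)\mapsto[a,b]$ is a bijection from $\mathbb{N}\times\mathbb{N}$ onto the monomials $t^k$, $k$ odd and positive. Say $[c,d]$ precedes (is earlier than) $[a,b]$ if $c+d<a+b$, or $c+d=a+b$ and $d<b$. "A sum of monomials" with some property means a finite sum (possibly empty, i.e. $0$) of distinct monomials with that property. When $b=0$, no monomial is "equal to or preceding $[0,b-1]$", so the condition then means $A_n=0$. -}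

module Defs where

open import Data.Nat using (ℕ; zero; suc; _+_; _*_; _^_; _<_; _≤_)
open import Data.Bool using (Bool; true; false; _xor_)
open import Data.Product using (Σ; _×_; ∃; ∃-syntax)
open import Data.Sum using (_⊎_)
open import Relation.Binary.PropositionalEquality using (_≡_)

-- g(0)=0, g(2n)=4g(n), g(2n+1)=g(2n)+1, via binary recursion with fuel
-- Straightforward definition: g n = sum of squares of the powers of 2 in n.
-- Implemented via halving with fuel.
half : ℕ → ℕ
half zero = zero
half (suc zero) = zero
half (suc (suc n)) = suc (half n)

parity : ℕ → ℕ
parity zero = 0
parity (suc zero) = 1
parity (suc (suc n)) = parity n

gFuel : ℕ → ℕ → ℕ
gFuel zero    _ = 0
gFuel (suc f) n = 4 * gFuel f (half n) + parity n

-- g n ; fuel n suffices since half strictly decreases positive arguments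
g : ℕ → ℕ
g n = gFuel n n

-- [a,b] as the exponent 1 + 2 g(a) + 4 g(b) of the monomial t^(1+2g(a)+4g(b))
bracket : ℕ → ℕ → ℕ
bracket a b = 1 + 2 * g a + 4 * g b

Precedes : ℕ → ℕ → ℕ → ℕ → Set
Precedes c d a b = (c + d < a + b) ⊎ ((c + d ≡ a + b) × (d < b))

-- Polynomials over ℤ/2 in t, represented by their coefficient functions
Poly : Set
Poly = ℕ → Bool

FinSupp : Poly → Set
FinSupp P = ∃[ B ] (∀ k → B ≤ k → P k ≡ false)

InTZ2T2 : Poly → Set
InTZ2T2 P = FinSupp P × (∀ k → P (2 * k) ≡ false)

_⊕_ : Poly → Poly → Poly
(P ⊕ Q) k = P k xor Q k

shift : ℕ → Poly → Poly
shift zero    P m       = P m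
shift (suc s) P zero    = false
shift (suc s) P (suc m) = shift s P m

IsOdd : ℕ → Set
IsOdd n = ∃[ j ] (n ≡ suc (2 * j))

Cond1α : Poly → ℕ → ℕ → Set
Cond1α P (suc a) b =
  (P (bracket a b) ≡ true) ×
  (∀ k → P k ≡ true → Σ ℕ λ c → Σ ℕ λ d →
     (k ≡ bracket c d) × ((c ≡ a × d ≡ b) ⊎ Precedes c d a b))
Cond1α P zero zero = ∀ k → P k ≡ false
Cond1α P zero (suc b) =
  ∀ k → P k ≡ true → Σ ℕ λ c → Σ ℕ λ d →
     (k ≡ bracket c d) × ((c ≡ 0 × d ≡ b) ⊎ Precedes c d 0 b)

Sat1α : (ℕ → Poly) → ℕ → Set
Sat1α A n = ∀ a b → n ≡ bracket a b → Cond1α (A n) a b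

-- Write t^(2k+1) = [c,d], so that k = ι c d interleaves the binary digits of c and d.  Multiplying by
-- t^(2·4^h) adds 4^h to k: it sets bit h of c, or carries, and a carry only lowers c + d below the
-- carry-free value; multiplying by t^(4·4^h) acts in the same way on d.  Hence these shifts move every
-- monomial equal to or preceding [a-1,b] to one equal to or preceding [a-1+2^h,b], resp. [a-1,b+2^h].
-- Substituting the recurrence into itself (cross terms cancel mod 2) gives it for every r = 2^j, j ≥ e.
-- For [a,b] with 2^(h+1) ≤ max(a,b) < 2^(h+2), h ≥ e, the recurrence with r = 4^h (if b < 2^(h+1)) or
-- r = 2·4^h writes A_[a,b] through two earlier A's, which satisfy (1α) by strong induction: the first is
-- shifted exactly onto the bound [a-1,b], the second stays below it, and [a-1,b] itself is produced by
-- exactly one of the two terms, which follows by inspecting bit h.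

module Submission where

open import Defs
open import Data.Bool using (Bool; true; false; _xor_)
open import Data.Bool.Properties using (¬-not)
open import Data.Empty using (⊥; ⊥-elim)
open import Data.Nat hiding (parity)
open import Data.Nat.DivMod using (_%_; _/_; m≡m%n+[m/n]*n; m%n<n; [m+kn]%n≡m%n; m<n⇒m%n≡m)
open import Data.Nat.Induction using (<-rec)
open import Data.Nat.Properties
open import Data.Nat.Tactic.RingSolver using (solve-∀)
open import Data.Product using (Σ; ∃; ∃₂; _×_; _,_; proj₁; proj₂; uncurry)
open import Data.Product.Properties using (,-injective)
open import Data.Sum using (_⊎_; inj₁; inj₂)
open import Relation.Binary.PropositionalEquality
open import Relation.Nullary using (¬_; yes; no; contradiction)
open import Algebra.Properties.CommutativeSemigroup +-commutativeSemigroup using (xy∙z≈xz∙y)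

private
  2+-bit : ∀ i k → i + 2 * suc k ≡ 2 + (i + 2 * k)
  2+-bit = solve-∀

  regroup-digits : ∀ x y z → x + 2 * y + 4 * z ≡ x + 2 * (y + 2 * z)
  regroup-digits = solve-∀

  suc-3+4* : ∀ z → suc (3 + 4 * z) ≡ 4 * suc z
  suc-3+4* = solve-∀

  +-*-suc-split : ∀ x w y → x + w * suc y ≡ x + w * y + w
  +-*-suc-split = solve-∀

  +-*-2+-split : ∀ x w y → x + w * (2 + y) ≡ x + w * y + 2 * w
  +-*-2+-split = solve-∀

  2^h>0 : ∀ h → 2 ^ h > 0
  2^h>0 = m^n>0 2

-- Binary digits

<-by : ∀ {x y} k → 0 < k → x + k ≡ y → x < y
<-by {x} k k>0 refl = m<m+n x k>0

≤⊎≤⇒¬<×< : ∀ {w a b} → w ≤ a ⊎ w ≤ b → a < w → b < w → ⊥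
≤⊎≤⇒¬<×< (inj₁ w≤a) a<w _ = <⇒≱ a<w w≤a
≤⊎≤⇒¬<×< (inj₂ w≤b) _ b<w = <⇒≱ b<w w≤b

split-at : ∀ W {x} → x < 2 * W → x < W ⊎ ∃ λ x′ → x′ < W × x ≡ x′ + W
split-at W {x} x<2W with x <? W
... | yes x<W = inj₁ x<W
... | no x≮W = inj₂ (x ∸ W , +-cancelʳ-< W (x ∸ W) W (subst (_< W + W) (sym x≡) x<W+W) , sym x≡)
  where
  x≡ : x ∸ W + W ≡ x
  x≡ = m∸n+n≡m (≮⇒≥ x≮W)
  x<W+W : x < W + W
  x<W+W = subst (x <_) (cong (W +_) (+-identityʳ W)) x<2W

parity≤1 : ∀ n → parity n ≤ 1
parity≤1 zero = z≤n
parity≤1 (suc zero) = ≤-refl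
parity≤1 (suc (suc n)) = parity≤1 n

parity+2*half : ∀ n → parity n + 2 * half n ≡ n
parity+2*half zero = refl
parity+2*half (suc zero) = refl
parity+2*half (suc (suc n)) = trans (2+-bit (parity n) (half n)) (cong (2 +_) (parity+2*half n))

half-bit : ∀ {i} k → i ≤ 1 → half (i + 2 * k) ≡ k
half-bit zero z≤n = refl
half-bit zero (s≤s z≤n) = refl
half-bit {i} (suc k) i≤1 = trans (cong half (2+-bit i k)) (cong suc (half-bit k i≤1))

parity-bit : ∀ {i} k → i ≤ 1 → parity (i + 2 * k) ≡ i
parity-bit zero z≤n = refl
parity-bit zero (s≤s z≤n) = refl
parity-bit {i} (suc k) i≤1 = trans (cong parity (2+-bit i k)) (parity-bit k i≤1)

≤suc⇒half≤ : ∀ {n f} → n ≤ suc f → half n ≤ f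
≤suc⇒half≤ {zero} _ = z≤n
≤suc⇒half≤ {suc zero} _ = z≤n
≤suc⇒half≤ {suc (suc n)} {suc f} (s≤s (s≤s n≤f)) = s≤s (≤suc⇒half≤ (m≤n⇒m≤1+n n≤f))

<2*⇒half< : ∀ {n P} → n < 2 * P → half n < P
<2*⇒half< {n} {P} n<2P = *-cancelˡ-< 2 (half n) P (≤-<-trans (m≤n+m (2 * half n) (parity n))
                                                    (subst (_< 2 * P) (sym (parity+2*half n)) n<2P))

gFuel-zero : ∀ f → gFuel f 0 ≡ 0
gFuel-zero zero = refl
gFuel-zero (suc f) = cong (λ x → 4 * x + 0) (gFuel-zero f)

gFuel-irrelevant : ∀ {f f′ n} → n ≤ f → n ≤ f′ → gFuel f n ≡ gFuel f′ n
gFuel-irrelevant {zero} {f′} z≤n _ = sym (gFuel-zero f′)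
gFuel-irrelevant {suc f} {zero} _ z≤n = gFuel-zero (suc f)
gFuel-irrelevant {suc f} {suc f′} {n} n≤f n≤f′ =
  cong (λ x → 4 * x + parity n) (gFuel-irrelevant (≤suc⇒half≤ n≤f) (≤suc⇒half≤ n≤f′))

g-digits : ∀ n → g n ≡ 4 * g (half n) + parity n
g-digits zero = refl
g-digits (suc n) = cong (λ x → 4 * x + parity (suc n))
  (gFuel-irrelevant {n} {half (suc n)} (≤suc⇒half≤ ≤-refl) ≤-refl)

g-bit : ∀ {i} k → i ≤ 1 → g (i + 2 * k) ≡ i + 4 * g k
g-bit {i} k i≤1 = begin
  g (i + 2 * k)                                     ≡⟨ g-digits (i + 2 * k) ⟩
  4 * g (half (i + 2 * k)) + parity (i + 2 * k)     ≡⟨ cong₂ (λ x y → 4 * g x + y) (half-bit k i≤1) (parity-bit k i≤1) ⟩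
  4 * g k + i                                       ≡⟨ +-comm (4 * g k) i ⟩
  i + 4 * g k                                       ∎
  where open ≡-Reasoning

-- The interleaving ι

ι : ℕ → ℕ → ℕ
ι c d = g c + 2 * g d

bracket≡ : ∀ c d → bracket c d ≡ suc (2 * ι c d)
bracket≡ c d = shape (g c) (g d)
  where
  shape : ∀ x y → 1 + 2 * x + 4 * y ≡ suc (2 * (x + 2 * y))
  shape = solve-∀

ι-bits : ∀ {i j} c d → i ≤ 1 → j ≤ 1 → ι (i + 2 * c) (j + 2 * d) ≡ i + 2 * j + 4 * ι c d
ι-bits {i} {j} c d i≤1 j≤1 =
  trans (cong₂ (λ x y → x + 2 * y) (g-bit c i≤1) (g-bit d j≤1)) (shape i j (g c) (g d))
  where
  shape : ∀ i j x y → i + 4 * x + 2 * (j + 4 * y) ≡ i + 2 * j + 4 * (x + 2 * y)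
  shape = solve-∀

ι-digits : ∀ c d → ι c d ≡ parity c + 2 * (parity d + 2 * ι (half c) (half d))
ι-digits c d = begin
  ι c d                                                   ≡⟨ sym (cong₂ ι (parity+2*half c) (parity+2*half d)) ⟩
  ι (pc + 2 * half c) (pd + 2 * half d)                   ≡⟨ ι-bits (half c) (half d) (parity≤1 c) (parity≤1 d) ⟩
  pc + 2 * pd + 4 * ι (half c) (half d)                   ≡⟨ regroup-digits pc pd (ι (half c) (half d)) ⟩
  pc + 2 * (pd + 2 * ι (half c) (half d))                 ∎
  where
  open ≡-Reasoning
  pc = parity c
  pd = parity d

unι : ℕ → ℕ → ℕ × ℕ
unι zero    k = 0 , 0
unι (suc f) k = parity k + 2 * proj₁ cd , parity (half k) + 2 * proj₂ cd
  where cd = unι f (half (half k))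

ι-unι : ∀ {f} k → k ≤ f → uncurry ι (unι f k) ≡ k
ι-unι {zero} zero z≤n = refl
ι-unι {suc f} k k≤f = begin
  ι (pk + 2 * proj₁ cd) (phk + 2 * proj₂ cd)    ≡⟨ ι-bits (proj₁ cd) (proj₂ cd) (parity≤1 k) (parity≤1 (half k)) ⟩
  pk + 2 * phk + 4 * uncurry ι cd               ≡⟨ cong (λ x → pk + 2 * phk + 4 * x) (ι-unι q q≤f) ⟩
  pk + 2 * phk + 4 * q                          ≡⟨ regroup-digits pk phk q ⟩
  pk + 2 * (phk + 2 * q)                        ≡⟨ cong (λ x → pk + 2 * x) (parity+2*half (half k)) ⟩
  pk + 2 * half k                               ≡⟨ parity+2*half k ⟩
  k                                             ∎
  where
  open ≡-Reasoning
  q = half (half k)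
  cd = unι f q
  pk = parity k
  phk = parity (half k)
  q≤f : q ≤ f
  q≤f = ≤suc⇒half≤ (m≤n⇒m≤1+n (≤suc⇒half≤ k≤f))

unι-ι : ∀ {f} c d → c ≤ f → d ≤ f → unι f (ι c d) ≡ (c , d)
unι-ι {zero} zero zero z≤n z≤n = refl
unι-ι {suc f} c d c≤f d≤f = begin
  unι (suc f) (ι c d)
    ≡⟨ cong₂ (λ i j → i + 2 * proj₁ (unι f (half (half (ι c d)))) , j + 2 * proj₂ (unι f (half (half (ι c d)))))
             parity₀ parity₁ ⟩
  (pc + 2 * proj₁ (unι f (half (half (ι c d)))) , pd + 2 * proj₂ (unι f (half (half (ι c d)))))
    ≡⟨ cong (λ q → pc + 2 * proj₁ (unι f q) , pd + 2 * proj₂ (unι f q)) quarter ⟩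
  (pc + 2 * proj₁ (unι f (ι hc hd)) , pd + 2 * proj₂ (unι f (ι hc hd)))
    ≡⟨ cong (λ p → pc + 2 * proj₁ p , pd + 2 * proj₂ p) (unι-ι hc hd (≤suc⇒half≤ c≤f) (≤suc⇒half≤ d≤f)) ⟩
  (pc + 2 * hc , pd + 2 * hd)
    ≡⟨ cong₂ _,_ (parity+2*half c) (parity+2*half d) ⟩
  (c , d) ∎
  where
  open ≡-Reasoning
  pc = parity c
  pd = parity d
  hc = half c
  hd = half d
  halved : half (ι c d) ≡ pd + 2 * ι hc hd
  halved = trans (cong half (ι-digits c d)) (half-bit (pd + 2 * ι hc hd) (parity≤1 c))
  parity₀ : parity (ι c d) ≡ pc
  parity₀ = trans (cong parity (ι-digits c d)) (parity-bit (pd + 2 * ι hc hd) (parity≤1 c))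
  parity₁ : parity (half (ι c d)) ≡ pd
  parity₁ = trans (cong parity halved) (parity-bit (ι hc hd) (parity≤1 d))
  quarter : half (half (ι c d)) ≡ ι hc hd
  quarter = trans (cong half halved) (half-bit (ι hc hd) (parity≤1 d))

ι-injective : ∀ {c d c′ d′} → ι c d ≡ ι c′ d′ → c ≡ c′ × d ≡ d′
ι-injective {c} {d} {c′} {d′} eq = ,-injective (begin
  (c , d)                 ≡⟨ sym (unι-ι c d (≤-trans (m≤m+n c d) ≤ˡ) (≤-trans (m≤n+m d c) ≤ˡ)) ⟩
  unι f (ι c d)           ≡⟨ cong (unι f) eq ⟩
  unι f (ι c′ d′)         ≡⟨ unι-ι c′ d′ (≤-trans (m≤m+n c′ d′) ≤ʳ) (≤-trans (m≤n+m d′ c′) ≤ʳ) ⟩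
  (c′ , d′)               ∎)
  where
  open ≡-Reasoning
  f = c + d + (c′ + d′)
  ≤ˡ : c + d ≤ f
  ≤ˡ = m≤m+n (c + d) (c′ + d′)
  ≤ʳ : c′ + d′ ≤ f
  ≤ʳ = m≤n+m (c′ + d′) (c + d)

ι-surjective : ∀ k → ∃₂ λ c d → ι c d ≡ k
ι-surjective k = proj₁ (unι k k) , proj₂ (unι k k) , ι-unι k ≤-refl

base-digits : ∀ W .{{_ : NonZero W}} x → ∃₂ λ x₀ x₁ → x₀ < W × x ≡ x₀ + W * x₁
base-digits W x = x % W , x / W , m%n<n x W , trans (m≡m%n+[m/n]*n x W) (cong (x % W +_) (*-comm (x / W) W))

base-digits-unique : ∀ {W} .{{_ : NonZero W}} {x₀ y₀ x₁ y₁} → x₀ < W → x₁ < W →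
                     x₀ + W * y₀ ≡ x₁ + W * y₁ → x₀ ≡ x₁ × y₀ ≡ y₁
base-digits-unique {W} {x₀} {y₀} {x₁} {y₁} x₀<W x₁<W eq = x₀≡x₁ , *-cancelˡ-≡ y₀ y₁ W (+-cancelˡ-≡ x₀ _ _ eq′)
  where
  open ≡-Reasoning
  x₀≡x₁ : x₀ ≡ x₁
  x₀≡x₁ = begin
    x₀                  ≡⟨ sym (m<n⇒m%n≡m x₀<W) ⟩
    x₀ % W              ≡⟨ sym ([m+kn]%n≡m%n x₀ y₀ W) ⟩
    (x₀ + y₀ * W) % W   ≡⟨ cong (λ z → (x₀ + z) % W) (*-comm y₀ W) ⟩
    (x₀ + W * y₀) % W   ≡⟨ cong (_% W) eq ⟩
    (x₁ + W * y₁) % W   ≡⟨ cong (λ z → (x₁ + z) % W) (*-comm W y₁) ⟩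
    (x₁ + y₁ * W) % W   ≡⟨ [m+kn]%n≡m%n x₁ y₁ W ⟩
    x₁ % W              ≡⟨ m<n⇒m%n≡m x₁<W ⟩
    x₁                  ∎
  eq′ : x₀ + W * y₀ ≡ x₀ + W * y₁
  eq′ = trans eq (cong (_+ W * y₁) (sym x₀≡x₁))

binary-digits : ∀ h x → ∃₂ λ x₀ x₁ → x₀ < 2 ^ h × x ≡ x₀ + 2 ^ h * x₁
binary-digits h = base-digits (2 ^ h) {{m^n≢0 2 h}}

ι-blocks : ∀ h {c₀ d₀} c₁ d₁ → c₀ < 2 ^ h → d₀ < 2 ^ h →
           ι (c₀ + 2 ^ h * c₁) (d₀ + 2 ^ h * d₁) ≡ ι c₀ d₀ + 4 ^ h * ι c₁ d₁
ι-blocks zero {zero} {zero} c₁ d₁ _ _ =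
  trans (cong₂ ι (*-identityˡ c₁) (*-identityˡ d₁)) (sym (*-identityˡ (ι c₁ d₁)))
ι-blocks zero {suc _} _ _ (s≤s ()) _
ι-blocks zero {zero} {suc _} _ _ _ (s≤s ())
ι-blocks (suc h) {c₀} {d₀} c₁ d₁ c₀<2W d₀<2W = begin
  ι (c₀ + 2 ^ suc h * c₁) (d₀ + 2 ^ suc h * d₁)
    ≡⟨ cong₂ ι (shift-digits c₀ c₁) (shift-digits d₀ d₁) ⟩
  ι (pc + 2 * (half c₀ + 2 ^ h * c₁)) (pd + 2 * (half d₀ + 2 ^ h * d₁))
    ≡⟨ ι-bits (half c₀ + 2 ^ h * c₁) (half d₀ + 2 ^ h * d₁) (parity≤1 c₀) (parity≤1 d₀) ⟩
  pc + 2 * pd + 4 * ι (half c₀ + 2 ^ h * c₁) (half d₀ + 2 ^ h * d₁)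
    ≡⟨ cong (λ x → pc + 2 * pd + 4 * x) (ι-blocks h c₁ d₁ (<2*⇒half< c₀<2W) (<2*⇒half< d₀<2W)) ⟩
  pc + 2 * pd + 4 * (ι (half c₀) (half d₀) + 4 ^ h * ι c₁ d₁)
    ≡⟨ regroup pc pd (ι (half c₀) (half d₀)) (4 ^ h * ι c₁ d₁) ⟩
  (pc + 2 * pd + 4 * ι (half c₀) (half d₀)) + 4 * (4 ^ h * ι c₁ d₁)
    ≡⟨ cong₂ _+_ (trans (regroup-digits pc pd (ι (half c₀) (half d₀))) (sym (ι-digits c₀ d₀)))
                 (sym (*-assoc 4 (4 ^ h) (ι c₁ d₁))) ⟩
  ι c₀ d₀ + 4 ^ suc h * ι c₁ d₁ ∎
  where
  open ≡-Reasoning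
  pc = parity c₀
  pd = parity d₀
  shift-digits : ∀ x y → x + 2 ^ suc h * y ≡ parity x + 2 * (half x + 2 ^ h * y)
  shift-digits x y = begin
    x + 2 * 2 ^ h * y                        ≡⟨ cong (_+ 2 * 2 ^ h * y) (sym (parity+2*half x)) ⟩
    parity x + 2 * half x + 2 * 2 ^ h * y    ≡⟨ factor (parity x) (half x) (2 ^ h) y ⟩
    parity x + 2 * (half x + 2 ^ h * y)      ∎
    where
    factor : ∀ p q w y → p + 2 * q + 2 * w * y ≡ p + 2 * (q + w * y)
    factor = solve-∀
  regroup : ∀ p q x y → p + 2 * q + 4 * (x + y) ≡ (p + 2 * q + 4 * x) + 4 * y
  regroup = solve-∀

ι-< : ∀ h {c d} → c < 2 ^ h → d < 2 ^ h → ι c d < 4 ^ h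
ι-< zero {zero} {zero} _ _ = s≤s z≤n
ι-< zero {suc _} (s≤s ()) _
ι-< zero {zero} {suc _} _ (s≤s ())
ι-< (suc h) {c} {d} c<2W d<2W = begin-strict
  ι c d                                    ≡⟨ trans (ι-digits c d) (sym (regroup-digits pc pd (ι (half c) (half d)))) ⟩
  pc + 2 * pd + 4 * ι (half c) (half d)    ≤⟨ +-monoˡ-≤ _ (+-mono-≤ (parity≤1 c) (*-monoʳ-≤ 2 (parity≤1 d))) ⟩
  3 + 4 * ι (half c) (half d)              <⟨ ≤-reflexive (suc-3+4* (ι (half c) (half d))) ⟩
  4 * suc (ι (half c) (half d))            ≤⟨ *-monoʳ-≤ 4 (ι-< h (<2*⇒half< c<2W) (<2*⇒half< d<2W)) ⟩
  4 ^ suc h                                ∎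
  where
  open ≤-Reasoning
  pc = parity c
  pd = parity d

ι-setBitˡ : ∀ k α b → α < 2 ^ k → ι (α + 2 ^ k) b ≡ ι α b + 4 ^ k
ι-setBitˡ k α b α<2^k with binary-digits k b
... | b₀ , b₁ , b₀<2^k , refl = begin
  ι (α + 2 ^ k) (b₀ + 2 ^ k * b₁)                ≡⟨ cong (λ x → ι (α + x) (b₀ + 2 ^ k * b₁)) (sym (*-identityʳ (2 ^ k))) ⟩
  ι (α + 2 ^ k * 1) (b₀ + 2 ^ k * b₁)            ≡⟨ ι-blocks k 1 b₁ α<2^k b₀<2^k ⟩
  ι α b₀ + 4 ^ k * suc (ι 0 b₁)                  ≡⟨ +-*-suc-split (ι α b₀) (4 ^ k) (ι 0 b₁) ⟩
  ι α b₀ + 4 ^ k * ι 0 b₁ + 4 ^ k                ≡⟨ cong (_+ 4 ^ k) (sym (ι-blocks k 0 b₁ α<2^k b₀<2^k)) ⟩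
  ι (α + 2 ^ k * 0) (b₀ + 2 ^ k * b₁) + 4 ^ k
    ≡⟨ cong (λ x → ι x (b₀ + 2 ^ k * b₁) + 4 ^ k) (trans (cong (α +_) (*-zeroʳ (2 ^ k))) (+-identityʳ α)) ⟩
  ι α (b₀ + 2 ^ k * b₁) + 4 ^ k                  ∎
  where open ≡-Reasoning

ι-setBitʳ : ∀ k a β → β < 2 ^ k → ι a (β + 2 ^ k) ≡ ι a β + 2 * 4 ^ k
ι-setBitʳ k a β β<2^k with binary-digits k a
... | a₀ , a₁ , a₀<2^k , refl = begin
  ι (a₀ + 2 ^ k * a₁) (β + 2 ^ k)                ≡⟨ cong (λ x → ι (a₀ + 2 ^ k * a₁) (β + x)) (sym (*-identityʳ (2 ^ k))) ⟩
  ι (a₀ + 2 ^ k * a₁) (β + 2 ^ k * 1)            ≡⟨ ι-blocks k a₁ 1 a₀<2^k β<2^k ⟩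
  ι a₀ β + 4 ^ k * (g a₁ + 2 * 1)                ≡⟨ split-2 (ι a₀ β) (4 ^ k) (g a₁) ⟩
  ι a₀ β + 4 ^ k * (g a₁ + 2 * 0) + 2 * 4 ^ k    ≡⟨ cong (_+ 2 * 4 ^ k) (sym (ι-blocks k a₁ 0 a₀<2^k β<2^k)) ⟩
  ι (a₀ + 2 ^ k * a₁) (β + 2 ^ k * 0) + 2 * 4 ^ k ≡⟨ cong (λ y → ι (a₀ + 2 ^ k * a₁) (β + y) + 2 * 4 ^ k) (*-zeroʳ (2 ^ k)) ⟩
  ι (a₀ + 2 ^ k * a₁) (β + 0) + 2 * 4 ^ k        ≡⟨ cong (λ y → ι (a₀ + 2 ^ k * a₁) y + 2 * 4 ^ k) (+-identityʳ β) ⟩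
  ι (a₀ + 2 ^ k * a₁) β + 2 * 4 ^ k              ∎
  where
  open ≡-Reasoning
  split-2 : ∀ x w y → x + w * (y + 2 * 1) ≡ x + w * (y + 2 * 0) + 2 * w
  split-2 = solve-∀

-- Adding to the index ι

SucShape : ℕ → ℕ → ℕ → ℕ → Set
SucShape c d c′ d′ = (c′ ≡ suc c × d′ ≡ d × IsOdd c′) ⊎ c′ + d′ ≤ c + d

SucShape-sum : ∀ {c d c′ d′} → SucShape c d c′ d′ → c′ + d′ ≤ suc (c + d)
SucShape-sum (inj₁ (refl , refl , _)) = ≤-refl
SucShape-sum (inj₂ le) = m≤n⇒m≤1+n le

private
  SucMotive : ℕ → Set
  SucMotive c = ∀ d {c′ d′} → ι c′ d′ ≡ suc (ι c d) → SucShape c d c′ d′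

  digits-of : ∀ c d → ι (parity c + 2 * half c) (parity d + 2 * half d) ≡ ι c d
  digits-of c d = cong₂ ι (parity+2*half c) (parity+2*half d)

  -- Adding 1 to ι (1 + 2x) (1 + 2y) carries into ι x y.
  ι-suc-bits : ∀ {i j} x y {c′ d′} → i ≤ 1 → j ≤ 1 → (∀ {x′} → x′ < i + 2 * x → SucMotive x′) →
               ι c′ d′ ≡ suc (ι (i + 2 * x) (j + 2 * y)) → SucShape (i + 2 * x) (j + 2 * y) c′ d′
  ι-suc-bits {j = j} x y {c′} {d′} z≤n j≤1 _ eq
    with ι-injective {c′} {d′} {1 + 2 * x} {j + 2 * y}
           (trans eq (trans (cong suc (ι-bits x y z≤n j≤1)) (sym (ι-bits x y (s≤s z≤n) j≤1))))
  ... | refl , refl = inj₁ (refl , refl , x , refl)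
  ι-suc-bits x y {c′} {d′} (s≤s z≤n) z≤n _ eq
    with ι-injective {c′} {d′} {0 + 2 * x} {1 + 2 * y}
           (trans eq (trans (cong suc (ι-bits x y (s≤s z≤n) z≤n)) (sym (ι-bits x y z≤n (s≤s z≤n)))))
  ... | refl , refl = inj₂ (≤-reflexive (+-suc (2 * x) (2 * y)))
  ι-suc-bits x y {c′} {d′} (s≤s z≤n) (s≤s z≤n) IH eq with ι-surjective (suc (ι x y))
  ... | x′ , y′ , carry
    with ι-injective {c′} {d′} {0 + 2 * x′} {0 + 2 * y′} (trans eq (trans (cong suc (ι-bits x y (s≤s z≤n) (s≤s z≤n)))
                                (trans (suc-3+4* (ι x y)) (trans (cong (4 *_) (sym carry)) (sym (ι-bits x′ y′ z≤n z≤n))))))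
  ... | refl , refl = inj₂ (begin
    2 * x′ + 2 * y′        ≡⟨ sym (*-distribˡ-+ 2 x′ y′) ⟩
    2 * (x′ + y′)          ≤⟨ *-monoʳ-≤ 2 (SucShape-sum (IH (m<1+n+m x) y {x′} {y′} carry)) ⟩
    2 * suc (x + y)        ≡⟨ two-suc x y ⟩
    1 + 2 * x + (1 + 2 * y) ∎)
    where
    open ≤-Reasoning
    m<1+n+m : ∀ x → x < 1 + 2 * x
    m<1+n+m x = s≤s (m≤m+n x (x + 0))
    two-suc : ∀ x y → 2 * suc (x + y) ≡ 1 + 2 * x + (1 + 2 * y)
    two-suc = solve-∀

ι-suc-shape : ∀ c d {c′ d′} → ι c′ d′ ≡ suc (ι c d) → SucShape c d c′ d′
ι-suc-shape = <-rec SucMotive λ c IH d eq →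
  subst₂ (λ u v → SucShape u v _ _) (parity+2*half c) (parity+2*half d)
    (ι-suc-bits (half c) (half d) (parity≤1 c) (parity≤1 d)
      (λ lt → IH (subst (_ <_) (parity+2*half c) lt))
      (trans eq (cong suc (sym (digits-of c d)))))

Suc²Shape : ℕ → ℕ → ℕ → ℕ → Set
Suc²Shape c d c′ d′ = (c′ ≡ c × d′ ≡ suc d × IsOdd d′) ⊎ (c′ ≡ 2 + c × suc d′ ≡ d) ⊎ c′ + d′ ≤ c + d

private
  2+-bits-even : ∀ i z → 2 + (i + 2 * 0 + 4 * z) ≡ i + 2 * 1 + 4 * z
  2+-bits-even = solve-∀

  2+-bits-odd : ∀ i z → 2 + (i + 2 * 1 + 4 * z) ≡ i + 2 * 0 + 4 * suc z
  2+-bits-odd = solve-∀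

  ι-suc²-bits : ∀ {i j} x y {c′ d′} → i ≤ 1 → j ≤ 1 →
                ι c′ d′ ≡ 2 + ι (i + 2 * x) (j + 2 * y) → Suc²Shape (i + 2 * x) (j + 2 * y) c′ d′
  ι-suc²-bits {i} x y {c′} {d′} i≤1 z≤n eq
    with ι-injective {c′} {d′} {i + 2 * x} {1 + 2 * y}
           (trans eq (trans (cong (2 +_) (ι-bits x y i≤1 z≤n))
                     (trans (2+-bits-even i (ι x y)) (sym (ι-bits x y i≤1 (s≤s z≤n))))))
  ... | refl , refl = inj₁ (refl , refl , y , refl)
  ι-suc²-bits {i} x y {c′} {d′} i≤1 (s≤s z≤n) eq with ι-surjective (suc (ι x y))
  ... | x′ , y′ , carry
    with ι-injective {c′} {d′} {i + 2 * x′} {0 + 2 * y′}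
           (trans eq (trans (cong (2 +_) (ι-bits x y i≤1 (s≤s z≤n)))
                     (trans (2+-bits-odd i (ι x y))
                     (trans (cong (λ z → i + 2 * 0 + 4 * z) (sym carry)) (sym (ι-bits x′ y′ i≤1 z≤n))))))
  ... | refl , refl with ι-suc-shape x y {x′} {y′} carry
  ...   | inj₁ (refl , refl , _) = inj₂ (inj₁ (2+-bit i x , refl))
  ...   | inj₂ le = inj₂ (inj₂ (begin
    i + 2 * x′ + 2 * y′           ≡⟨ +-assoc i (2 * x′) (2 * y′) ⟩
    i + (2 * x′ + 2 * y′)         ≡⟨ cong (i +_) (sym (*-distribˡ-+ 2 x′ y′)) ⟩
    i + 2 * (x′ + y′)             ≤⟨ +-monoʳ-≤ i (*-monoʳ-≤ 2 le) ⟩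
    i + 2 * (x + y)               ≤⟨ ≤-reflexive (regroup i x y) ⟩
    i + 2 * x + 2 * y             ≤⟨ +-monoʳ-≤ (i + 2 * x) (n≤1+n (2 * y)) ⟩
    i + 2 * x + (1 + 2 * y)       ∎))
    where
    open ≤-Reasoning
    regroup : ∀ i x y → i + 2 * (x + y) ≡ i + 2 * x + 2 * y
    regroup = solve-∀

ι-suc²-shape : ∀ c d {c′ d′} → ι c′ d′ ≡ 2 + ι c d → Suc²Shape c d c′ d′
ι-suc²-shape c d eq =
  subst₂ (λ u v → Suc²Shape u v _ _) (parity+2*half c) (parity+2*half d)
    (ι-suc²-bits (half c) (half d) (parity≤1 c) (parity≤1 d) (trans eq (cong (2 +_) (sym (digits-of c d)))))

HasBit : ℕ → ℕ → Set
HasBit h x = ∃₂ λ x₀ k → x₀ < 2 ^ h × x ≡ x₀ + 2 ^ h * suc (2 * k)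

HasBit⇒2^≤ : ∀ {h x} → HasBit h x → 2 ^ h ≤ x
HasBit⇒2^≤ {h} (x₀ , k , _ , refl) = ≤-trans (m≤m*n (2 ^ h) (suc (2 * k))) (m≤n+m _ x₀)

¬HasBit-even : ∀ {h x₀} k → x₀ < 2 ^ h → ¬ HasBit h (x₀ + 2 ^ h * (2 * k))
¬HasBit-even {h} k x₀<2^h (x₁ , k′ , x₁<2^h , eq) with base-digits-unique {{m^n≢0 2 h}} x₀<2^h x₁<2^h eq
... | _ , 2k≡1+2k′ with trans (sym (parity-bit k z≤n)) (trans (cong parity 2k≡1+2k′) (parity-bit k′ (s≤s z≤n)))
... | ()

ι-blocks-shift : ∀ h {c₀ d₀ c₀′ d₀′} c₁ d₁ c₁′ d₁′ t →
                 c₀ < 2 ^ h → d₀ < 2 ^ h → c₀′ < 2 ^ h → d₀′ < 2 ^ h →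
                 ι (c₀′ + 2 ^ h * c₁′) (d₀′ + 2 ^ h * d₁′) ≡ ι (c₀ + 2 ^ h * c₁) (d₀ + 2 ^ h * d₁) + 4 ^ h * t →
                 c₀′ ≡ c₀ × d₀′ ≡ d₀ × ι c₁′ d₁′ ≡ ι c₁ d₁ + t
ι-blocks-shift h {c₀} {d₀} {c₀′} {d₀′} c₁ d₁ c₁′ d₁′ t c₀< d₀< c₀′< d₀′< eq
  with base-digits-unique {{m^n≢0 4 h}} (ι-< h c₀′< d₀′<) (ι-< h c₀< d₀<) blocks
  where
  blocks : ι c₀′ d₀′ + 4 ^ h * ι c₁′ d₁′ ≡ ι c₀ d₀ + 4 ^ h * (ι c₁ d₁ + t)
  blocks = begin
    ι c₀′ d₀′ + 4 ^ h * ι c₁′ d₁′                     ≡⟨ sym (ι-blocks h c₁′ d₁′ c₀′< d₀′<) ⟩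
    ι (c₀′ + 2 ^ h * c₁′) (d₀′ + 2 ^ h * d₁′)         ≡⟨ eq ⟩
    ι (c₀ + 2 ^ h * c₁) (d₀ + 2 ^ h * d₁) + 4 ^ h * t ≡⟨ cong (_+ 4 ^ h * t) (ι-blocks h c₁ d₁ c₀< d₀<) ⟩
    ι c₀ d₀ + 4 ^ h * ι c₁ d₁ + 4 ^ h * t             ≡⟨ +-assoc (ι c₀ d₀) _ _ ⟩
    ι c₀ d₀ + (4 ^ h * ι c₁ d₁ + 4 ^ h * t)           ≡⟨ cong (ι c₀ d₀ +_) (sym (*-distribˡ-+ (4 ^ h) (ι c₁ d₁) t)) ⟩
    ι c₀ d₀ + 4 ^ h * (ι c₁ d₁ + t)                   ∎
    where open ≡-Reasoning
... | low , high with ι-injective {c₀′} {d₀′} {c₀} {d₀} low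
... | refl , refl = refl , refl , high

private
  blocks-+-≤ : ∀ W c₀ d₀ c₁ d₁ c₁′ d₁′ → c₁′ + d₁′ ≤ c₁ + d₁ →
               c₀ + W * c₁′ + (d₀ + W * d₁′) ≤ c₀ + W * c₁ + (d₀ + W * d₁)
  blocks-+-≤ W c₀ d₀ c₁ d₁ c₁′ d₁′ le = begin
    c₀ + W * c₁′ + (d₀ + W * d₁′)    ≡⟨ regroup c₀ d₀ W c₁′ d₁′ ⟩
    c₀ + d₀ + W * (c₁′ + d₁′)        ≤⟨ +-monoʳ-≤ (c₀ + d₀) (*-monoʳ-≤ W le) ⟩
    c₀ + d₀ + W * (c₁ + d₁)          ≡⟨ sym (regroup c₀ d₀ W c₁ d₁) ⟩
    c₀ + W * c₁ + (d₀ + W * d₁)      ∎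
    where
    open ≤-Reasoning
    regroup : ∀ a b w x y → a + w * x + (b + w * y) ≡ a + b + w * (x + y)
    regroup = solve-∀

  blocks-+-< : ∀ h c₀ d₀ c₁ d₁ c₁′ d₁′ → c₁′ + d₁′ ≤ c₁ + d₁ →
               c₀ + 2 ^ h * c₁′ + (d₀ + 2 ^ h * d₁′) < c₀ + 2 ^ h * c₁ + (d₀ + 2 ^ h * d₁) + 2 ^ h
  blocks-+-< h c₀ d₀ c₁ d₁ c₁′ d₁′ le =
    ≤-<-trans (blocks-+-≤ (2 ^ h) c₀ d₀ c₁ d₁ c₁′ d₁′ le) (m<m+n _ (2^h>0 h))

ι-+4^-shape : ∀ h {c d c′ d′} → ι c′ d′ ≡ ι c d + 4 ^ h →
              (c′ ≡ c + 2 ^ h × d′ ≡ d × HasBit h c′) ⊎ c′ + d′ < c + d + 2 ^ h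
ι-+4^-shape h {c} {d} {c′} {d′} eq
  with binary-digits h c | binary-digits h d | binary-digits h c′ | binary-digits h d′
... | c₀ , c₁ , c₀< , refl | d₀ , d₁ , d₀< , refl | c₀′ , c₁′ , c₀′< , refl | d₀′ , d₁′ , d₀′< , refl
  with ι-blocks-shift h c₁ d₁ c₁′ d₁′ 1 c₀< d₀< c₀′< d₀′<
         (trans eq (cong (ι (c₀ + 2 ^ h * c₁) (d₀ + 2 ^ h * d₁) +_) (sym (*-identityʳ (4 ^ h)))))
... | refl , refl , high with ι-suc-shape c₁ d₁ {c₁′} {d₁′} (trans high (+-comm _ 1))
... | inj₁ (refl , refl , k , odd) = inj₁ (+-*-suc-split c₀ (2 ^ h) c₁ , refl , c₀ , k , c₀< , cong (λ z → c₀ + 2 ^ h * z) odd)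
... | inj₂ le = inj₂ (blocks-+-< h c₀ d₀ c₁ d₁ c₁′ d₁′ le)

ι-+2*4^-shape : ∀ h {c d c′ d′} → ι c′ d′ ≡ ι c d + 2 * 4 ^ h →
                (c′ ≡ c × d′ ≡ d + 2 ^ h × HasBit h d′) ⊎
                (c′ ≡ c + 2 * 2 ^ h × d′ + 2 ^ h ≡ d) ⊎
                c′ + d′ < c + d + 2 ^ h
ι-+2*4^-shape h {c} {d} {c′} {d′} eq
  with binary-digits h c | binary-digits h d | binary-digits h c′ | binary-digits h d′
... | c₀ , c₁ , c₀< , refl | d₀ , d₁ , d₀< , refl | c₀′ , c₁′ , c₀′< , refl | d₀′ , d₁′ , d₀′< , refl
  with ι-blocks-shift h c₁ d₁ c₁′ d₁′ 2 c₀< d₀< c₀′< d₀′<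
         (trans eq (cong (ι (c₀ + 2 ^ h * c₁) (d₀ + 2 ^ h * d₁) +_) (*-comm 2 (4 ^ h))))
... | refl , refl , high with ι-suc²-shape c₁ d₁ {c₁′} {d₁′} (trans high (+-comm _ 2))
... | inj₁ (refl , refl , k , odd) = inj₁ (refl , +-*-suc-split d₀ (2 ^ h) d₁ , d₀ , k , d₀< , cong (λ z → d₀ + 2 ^ h * z) odd)
... | inj₂ (inj₁ (refl , refl)) = inj₂ (inj₁ (+-*-2+-split c₀ (2 ^ h) c₁ , sym (+-*-suc-split d₀ (2 ^ h) d₁′)))
... | inj₂ (inj₂ le) = inj₂ (inj₂ (blocks-+-< h c₀ d₀ c₁ d₁ c₁′ d₁′ le))

-- Keys of monomials

_≤ₗ_ : ℕ × ℕ → ℕ × ℕ → Set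
κ ≤ₗ κ′ = proj₁ κ < proj₁ κ′ ⊎ (proj₁ κ ≡ proj₁ κ′ × proj₂ κ ≤ proj₂ κ′)

_<ₗ_ : ℕ × ℕ → ℕ × ℕ → Set
κ <ₗ κ′ = proj₁ κ < proj₁ κ′ ⊎ (proj₁ κ ≡ proj₁ κ′ × proj₂ κ < proj₂ κ′)

≤ₗ-trans : ∀ {κ₁ κ₂ κ₃} → κ₁ ≤ₗ κ₂ → κ₂ ≤ₗ κ₃ → κ₁ ≤ₗ κ₃
≤ₗ-trans (inj₁ p) (inj₁ q) = inj₁ (<-trans p q)
≤ₗ-trans (inj₁ p) (inj₂ (refl , _)) = inj₁ p
≤ₗ-trans (inj₂ (refl , _)) (inj₁ q) = inj₁ q
≤ₗ-trans (inj₂ (refl , p)) (inj₂ (refl , q)) = inj₂ (refl , ≤-trans p q)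

≡⇒≤ₗ : ∀ {κ κ′} → κ ≡ κ′ → κ ≤ₗ κ′
≡⇒≤ₗ refl = inj₂ (refl , ≤-refl)

<ₗ⇒≤ₗ : ∀ {κ κ′} → κ <ₗ κ′ → κ ≤ₗ κ′
<ₗ⇒≤ₗ (inj₁ p) = inj₁ p
<ₗ⇒≤ₗ (inj₂ (e , p)) = inj₂ (e , <⇒≤ p)

≤ₗ⇒≯ₗ : ∀ {κ κ′} → κ ≤ₗ κ′ → ¬ κ′ <ₗ κ
≤ₗ⇒≯ₗ (inj₁ p) (inj₁ q) = <-asym p q
≤ₗ⇒≯ₗ (inj₁ p) (inj₂ (refl , _)) = <-irrefl refl p
≤ₗ⇒≯ₗ (inj₂ (refl , _)) (inj₁ q) = <-irrefl refl q
≤ₗ⇒≯ₗ (inj₂ (refl , p)) (inj₂ (_ , q)) = <-irrefl refl (≤-<-trans p q)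

≤ₗ-+ˡ : ∀ {s t s′ t′} k → (s , t) ≤ₗ (s′ , t′) → (s + k , t) ≤ₗ (s′ + k , t′)
≤ₗ-+ˡ k (inj₁ p) = inj₁ (+-monoˡ-< k p)
≤ₗ-+ˡ k (inj₂ (refl , p)) = inj₂ (refl , p)

≤ₗ-+ : ∀ {s t s′ t′} k → (s , t) ≤ₗ (s′ , t′) → (s + k , t + k) ≤ₗ (s′ + k , t′ + k)
≤ₗ-+ k (inj₁ p) = inj₁ (+-monoˡ-< k p)
≤ₗ-+ k (inj₂ (refl , p)) = inj₂ (refl , +-monoˡ-≤ k p)

≤ₗ-lowerʳ : ∀ {s t t₀ κ} → t₀ ≤ t → (s , t) ≤ₗ κ → (s , t₀) ≤ₗ κ
≤ₗ-lowerʳ _ (inj₁ p) = inj₁ p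
≤ₗ-lowerʳ t₀≤t (inj₂ (e , p)) = inj₂ (e , ≤-trans t₀≤t p)

-- Under c d (a + b , b) says that [c,d] is [a-1,b] or precedes it; for a = 0 it is (1α)'s condition with [0,b-1].
Under : ℕ → ℕ → ℕ × ℕ → Set
Under c d κ = (suc (c + d) , d) ≤ₗ κ

Under⇒≤ : ∀ {c d κ} → Under c d κ → suc (c + d) ≤ proj₁ κ
Under⇒≤ (inj₁ p) = <⇒≤ p
Under⇒≤ (inj₂ (e , _)) = ≤-reflexive e

private
  <-+-Under : ∀ {m n s k} → m < n + k → suc n ≤ s → suc m < s + k
  <-+-Under {k = k} lt le = <-≤-trans (s≤s lt) (+-monoˡ-≤ k le)

  suc-+-swap : ∀ c d k → suc (c + k + d) ≡ suc (c + d) + k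
  suc-+-swap = solve-∀

Under-+4^ : ∀ h {c d c′ d′ s t} → Under c d (s , t) → ι c′ d′ ≡ ι c d + 4 ^ h → Under c′ d′ (s + 2 ^ h , t)
Under-+4^ h {c} {d} {c′} {d′} {s} {t} u eq with ι-+4^-shape h {c} {d} {c′} {d′} eq
... | inj₁ (refl , refl , _) = subst (λ z → (z , d) ≤ₗ (s + 2 ^ h , t)) (sym (suc-+-swap c d (2 ^ h))) (≤ₗ-+ˡ (2 ^ h) u)
... | inj₂ lt = inj₁ (<-+-Under lt (Under⇒≤ u))

private
  suc-+-2*-swap : ∀ c d k → suc (c + 2 * k + d) ≡ suc (c + (d + k)) + k
  suc-+-2*-swap = solve-∀

Under-+2*4^ : ∀ h {c d c′ d′ s t} → Under c d (s , t) → ι c′ d′ ≡ ι c d + 2 * 4 ^ h →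
              Under c′ d′ (s + 2 ^ h , t + 2 ^ h)
Under-+2*4^ h {c} {d} {c′} {d′} {s} {t} u eq with ι-+2*4^-shape h {c} {d} {c′} {d′} eq
... | inj₁ (refl , refl , _) =
  subst (λ z → (suc z , d + 2 ^ h) ≤ₗ (s + 2 ^ h , t + 2 ^ h)) (+-assoc c d (2 ^ h)) (≤ₗ-+ (2 ^ h) u)
... | inj₂ (inj₁ (refl , refl)) =
  subst (λ z → (z , d′) ≤ₗ (s + 2 ^ h , t + 2 ^ h)) (sym (suc-+-2*-swap c d′ (2 ^ h)))
    (≤ₗ-lowerʳ (≤-trans (m≤m+n d′ (2 ^ h)) (m≤m+n (d′ + 2 ^ h) (2 ^ h))) (≤ₗ-+ (2 ^ h) u))
... | inj₂ (inj₂ lt) = inj₁ (<-+-Under lt (Under⇒≤ u))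

-- A shifted monomial reaches the shifted bound only if the addition did not carry, which leaves bit h set.
Under-+4^-tight : ∀ h {c d x y s t} → Under c d (s , t) → ι x y ≡ ι c d + 4 ^ h →
                  suc (x + y) ≡ s + 2 ^ h → HasBit h x
Under-+4^-tight h {c} {d} {x} {y} u eq tight with ι-+4^-shape h {c} {d} {x} {y} eq
... | inj₁ (_ , _ , bit) = bit
... | inj₂ lt = ⊥-elim (<-irrefl tight (<-+-Under lt (Under⇒≤ u)))

Under-+2*4^-tight : ∀ h {c d x y s t} → Under c d (s , t) → ι x y ≡ ι c d + 2 * 4 ^ h →
                    suc (x + y) ≡ s + 2 ^ h → t < y → HasBit h y
Under-+2*4^-tight h {c} {d} {x} {y} {s} u eq tight t<y with ι-+2*4^-shape h {c} {d} {x} {y} eq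
... | inj₁ (_ , _ , bit) = bit
... | inj₂ (inj₁ (refl , refl)) with u
...   | inj₁ p = ⊥-elim (<-irrefl (+-cancelʳ-≡ (2 ^ h) _ s (trans (sym (suc-+-2*-swap c y (2 ^ h))) tight)) p)
...   | inj₂ (_ , p) = ⊥-elim (<-irrefl refl (<-≤-trans t<y (≤-trans (m≤m+n y (2 ^ h)) p)))
Under-+2*4^-tight h u eq tight t<y | inj₂ (inj₂ lt) = ⊥-elim (<-irrefl tight (<-+-Under lt (Under⇒≤ u)))

-- Polynomials

shift-+ : ∀ s P k → shift s P (s + k) ≡ P k
shift-+ zero P k = refl
shift-+ (suc s) P k = shift-+ s P k

shift-true : ∀ s P k → shift s P k ≡ true → ∃ λ k₀ → k ≡ s + k₀ × P k₀ ≡ true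
shift-true zero P k e = k , refl , e
shift-true (suc s) P (suc k) e with shift-true s P k e
... | k₀ , refl , e′ = k₀ , refl , e′

shift-cong : ∀ s {P Q} → P ≗ Q → shift s P ≗ shift s Q
shift-cong zero P≗Q k = P≗Q k
shift-cong (suc s) P≗Q zero = refl
shift-cong (suc s) P≗Q (suc k) = shift-cong s P≗Q k

shift-⊕ : ∀ s P Q → shift s (P ⊕ Q) ≗ shift s P ⊕ shift s Q
shift-⊕ zero P Q k = refl
shift-⊕ (suc s) P Q zero = refl
shift-⊕ (suc s) P Q (suc k) = shift-⊕ s P Q k

shift-shift : ∀ s t P → shift s (shift t P) ≗ shift (s + t) P
shift-shift zero t P k = refl
shift-shift (suc s) t P zero = refl
shift-shift (suc s) t P (suc k) = shift-shift s t P k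

bracket-+ : ∀ x y c d X → ι x y ≡ ι c d + X → bracket x y ≡ 2 * X + bracket c d
bracket-+ x y c d X eq = begin
  bracket x y              ≡⟨ bracket≡ x y ⟩
  suc (2 * ι x y)          ≡⟨ cong (λ z → suc (2 * z)) eq ⟩
  suc (2 * (ι c d + X))    ≡⟨ distrib X (ι c d) ⟩
  2 * X + suc (2 * ι c d)  ≡⟨ cong (2 * X +_) (sym (bracket≡ c d)) ⟩
  2 * X + bracket c d      ∎
  where
  open ≡-Reasoning
  distrib : ∀ X z → suc (2 * (z + X)) ≡ 2 * X + suc (2 * z)
  distrib = solve-∀

bracket-+⁻¹ : ∀ x y c d X → bracket x y ≡ 2 * X + bracket c d → ι x y ≡ ι c d + X
bracket-+⁻¹ x y c d X eq = *-cancelˡ-≡ (ι x y) (ι c d + X) 2 (suc-injective (begin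
  suc (2 * ι x y)          ≡⟨ sym (bracket≡ x y) ⟩
  bracket x y              ≡⟨ eq ⟩
  2 * X + bracket c d      ≡⟨ cong (2 * X +_) (bracket≡ c d) ⟩
  2 * X + suc (2 * ι c d)  ≡⟨ distrib X (ι c d) ⟩
  suc (2 * (ι c d + X))    ∎))
  where
  open ≡-Reasoning
  distrib : ∀ X z → 2 * X + suc (2 * z) ≡ suc (2 * (z + X))
  distrib = solve-∀

bracket-injective : ∀ {x y c d} → bracket x y ≡ bracket c d → x ≡ c × y ≡ d
bracket-injective {x} {y} {c} {d} eq =
  ι-injective (*-cancelˡ-≡ (ι x y) (ι c d) 2 (suc-injective (trans (sym (bracket≡ x y)) (trans eq (bracket≡ c d)))))

-- Multiplying by t^(2·4^h), resp. t^(4·4^h), adds 4^h, resp. 2·4^h, to the index ι of each monomial.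
colShift rowShift : ℕ → Poly → Poly
colShift h = shift (2 * 4 ^ h)
rowShift h = shift (2 * (2 * 4 ^ h))

AllUnder : Poly → ℕ × ℕ → Set
AllUnder P κ = ∀ k → P k ≡ true → ∃₂ λ c d → k ≡ bracket c d × Under c d κ

HasLead : Poly → ℕ → ℕ → Set
HasLead P a b = ∀ {a′} → a ≡ suc a′ → P (bracket a′ b) ≡ true

Cond : Poly → ℕ → ℕ → Set
Cond P a b = AllUnder P (a + b , b) × HasLead P a b

Cond-≗ : ∀ {P Q a b} → P ≗ Q → Cond Q a b → Cond P a b
Cond-≗ P≗Q (under , lead) = (λ k e → under k (trans (sym (P≗Q k)) e)) , λ e → trans (P≗Q _) (lead e)

AllUnder-mono : ∀ {P κ κ′} → κ ≤ₗ κ′ → AllUnder P κ → AllUnder P κ′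
AllUnder-mono κ≤κ′ under k e with under k e
... | c , d , refl , u = c , d , refl , ≤ₗ-trans u κ≤κ′

AllUnder-⊕ : ∀ {P Q κ} → AllUnder P κ → AllUnder Q κ → AllUnder (P ⊕ Q) κ
AllUnder-⊕ {P} {Q} underP underQ k e with P k in eP
... | true = underP k eP
... | false = underQ k e

shift-source : ∀ X {P κ} x y → AllUnder P κ → shift (2 * X) P (bracket x y) ≡ true →
               ∃₂ λ c d → Under c d κ × ι x y ≡ ι c d + X
shift-source X {P} x y under e with shift-true (2 * X) P (bracket x y) e
... | k₀ , k≡ , e₀ with under k₀ e₀
... | c , d , refl , u = c , d , u , bracket-+⁻¹ x y c d X k≡

AllUnder-shift : ∀ X {P κ κ′} → (∀ {c d c′ d′} → Under c d κ → ι c′ d′ ≡ ι c d + X → Under c′ d′ κ′) →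
                 AllUnder P κ → AllUnder (shift (2 * X) P) κ′
AllUnder-shift X {P} move under k e with shift-true (2 * X) P k e
... | k₀ , refl , e₀ with under k₀ e₀
... | c , d , refl , u with ι-surjective (ι c d + X)
... | c′ , d′ , moved = c′ , d′ , sym (bracket-+ c′ d′ c d X moved) , move u moved

AllUnder-shiftCol : ∀ h {P s t} → AllUnder P (s , t) → AllUnder (colShift h P) (s + 2 ^ h , t)
AllUnder-shiftCol h = AllUnder-shift (4 ^ h) (Under-+4^ h)

AllUnder-shiftRow : ∀ h {P s t} → AllUnder P (s , t) → AllUnder (rowShift h P) (s + 2 ^ h , t + 2 ^ h)
AllUnder-shiftRow h = AllUnder-shift (2 * 4 ^ h) (Under-+2*4^ h)

absent-below : ∀ {Q κ a b} → AllUnder Q κ → κ <ₗ (a + b , b) → ∀ {a′} → a ≡ suc a′ → Q (bracket a′ b) ≡ false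
absent-below {Q} {κ} {b = b} under κ< {a′} refl = ¬-not present
  where
  present : ¬ Q (bracket a′ b) ≡ true
  present e with under (bracket a′ b) e
  ... | c , d , eq , u with bracket-injective {a′} {b} {c} {d} eq
  ... | refl , refl = ≤ₗ⇒≯ₗ u κ<

absent-tightCol : ∀ h {P s t x y} → AllUnder P (s , t) → ¬ HasBit h x → suc (x + y) ≡ s + 2 ^ h →
                  colShift h P (bracket x y) ≡ false
absent-tightCol h {x = x} {y} under ¬bit tight = ¬-not λ e →
  let (c , d , u , eq) = shift-source (4 ^ h) x y under e in ¬bit (Under-+4^-tight h {c} {d} {x} {y} u eq tight)

absent-tightRow : ∀ h {P s t x y} → AllUnder P (s , t) → ¬ HasBit h y → suc (x + y) ≡ s + 2 ^ h → t < y →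
                  rowShift h P (bracket x y) ≡ false
absent-tightRow h {x = x} {y} under ¬bit tight t<y = ¬-not λ e →
  let (c , d , u , eq) = shift-source (2 * 4 ^ h) x y under e in ¬bit (Under-+2*4^-tight h {c} {d} {x} {y} u eq tight t<y)

shift-lead : ∀ X {P a₀ b} x y → HasLead P (suc a₀) b → ι x y ≡ ι a₀ b + X → shift (2 * X) P (bracket x y) ≡ true
shift-lead X {P} {a₀} {b} x y lead eq =
  trans (cong (shift (2 * X) P) (bracket-+ x y a₀ b X eq)) (trans (shift-+ (2 * X) P (bracket a₀ b)) (lead refl))

HasLead-shiftCol : ∀ h {P a b} → 0 < a → a < 2 ^ h → HasLead P a b → HasLead (colShift h P) (a + 2 ^ h) b
HasLead-shiftCol h {a = suc a₀} {b} _ a<2^h lead refl =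
  shift-lead (4 ^ h) {a₀ = a₀} {b} (a₀ + 2 ^ h) b lead (ι-setBitˡ h a₀ b (<-trans (n<1+n a₀) a<2^h))

HasLead-shiftRow : ∀ h {P a b} → b < 2 ^ h → HasLead P a b → HasLead (rowShift h P) a (b + 2 ^ h)
HasLead-shiftRow h {b = b} b<2^h lead {a′} refl =
  shift-lead (2 * 4 ^ h) {a₀ = a′} {b} a′ (b + 2 ^ h) lead (ι-setBitʳ h a′ b b<2^h)

HasLead-⊕ˡ : ∀ {P Q a b} → HasLead P a b → (∀ {a′} → a ≡ suc a′ → Q (bracket a′ b) ≡ false) → HasLead (P ⊕ Q) a b
HasLead-⊕ˡ leadP absentQ e = cong₂ _xor_ (leadP e) (absentQ e)

HasLead-⊕ʳ : ∀ {P Q a b} → (∀ {a′} → a ≡ suc a′ → P (bracket a′ b) ≡ false) → HasLead Q a b → HasLead (P ⊕ Q) a b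
HasLead-⊕ʳ absentP leadQ e = cong₂ _xor_ (absentP e) (leadQ e)

Cond1α⇒Cond : ∀ P a b → Cond1α P a b → Cond P a b
Cond1α⇒Cond P (suc a₀) b (lead , terms) = under , λ { refl → lead }
  where
  under : AllUnder P (suc a₀ + b , b)
  under k e with terms k e
  ... | c , d , k≡ , inj₁ (refl , refl) = c , d , k≡ , inj₂ (refl , ≤-refl)
  ... | c , d , k≡ , inj₂ (inj₁ lt) = c , d , k≡ , inj₁ (s≤s lt)
  ... | c , d , k≡ , inj₂ (inj₂ (eq , lt)) = c , d , k≡ , inj₂ (cong suc eq , <⇒≤ lt)
Cond1α⇒Cond P zero zero none = (λ k e → contradiction (trans (sym e) (none k)) λ ()) , λ ()
Cond1α⇒Cond P zero (suc b₀) terms = under , λ ()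
  where
  under : AllUnder P (suc b₀ , suc b₀)
  under k e with terms k e
  ... | c , d , k≡ , inj₁ (refl , refl) = c , d , k≡ , inj₂ (refl , n≤1+n d)
  ... | c , d , k≡ , inj₂ (inj₁ lt) = c , d , k≡ , inj₁ (s≤s lt)
  ... | c , d , k≡ , inj₂ (inj₂ (eq , lt)) = c , d , k≡ , inj₂ (cong suc eq , ≤-trans (<⇒≤ lt) (n≤1+n b₀))

Cond⇒Cond1α : ∀ P a b → Cond P a b → Cond1α P a b
Cond⇒Cond1α P (suc a₀) b (under , lead) = lead refl , terms
  where
  terms : ∀ k → P k ≡ true → Σ ℕ λ c → Σ ℕ λ d → (k ≡ bracket c d) × ((c ≡ a₀ × d ≡ b) ⊎ Precedes c d a₀ b)
  terms k e with under k e
  ... | c , d , k≡ , inj₁ (s≤s lt) = c , d , k≡ , inj₂ (inj₁ lt)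
  ... | c , d , k≡ , inj₂ (eq , d≤b) with m≤n⇒m<n∨m≡n d≤b
  ...   | inj₁ lt = c , d , k≡ , inj₂ (inj₂ (suc-injective eq , lt))
  ...   | inj₂ refl = c , d , k≡ , inj₁ (+-cancelʳ-≡ d c a₀ (suc-injective eq) , refl)
Cond⇒Cond1α P zero zero (under , _) k with P k in e
... | false = refl
... | true with under k e
...   | _ , _ , _ , inj₁ ()
...   | _ , _ , _ , inj₂ (() , _)
Cond⇒Cond1α P zero (suc b₀) (under , _) = terms
  where
  terms : ∀ k → P k ≡ true → Σ ℕ λ c → Σ ℕ λ d → (k ≡ bracket c d) × ((c ≡ 0 × d ≡ b₀) ⊎ Precedes c d 0 b₀)
  terms k e with under k e
  ... | c , d , k≡ , inj₁ (s≤s lt) = c , d , k≡ , inj₂ (inj₁ lt)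
  ... | c , d , k≡ , inj₂ (eq , _) with m≤n⇒m<n∨m≡n (subst (d ≤_) (suc-injective eq) (m≤n+m d c))
  ...   | inj₁ lt = c , d , k≡ , inj₂ (inj₂ (suc-injective eq , lt))
  ...   | inj₂ refl = c , d , k≡ , inj₁ (+-cancelʳ-≡ d c 0 (suc-injective eq) , refl)

-- The recurrence

Recurrence : (ℕ → Poly) → ℕ → Set
Recurrence A r = ∀ n → IsOdd n → A (n + 8 * r) ≗ shift (8 * r) (A n) ⊕ shift (2 * r) (A (n + 2 * r))

IsOdd-+2* : ∀ {n} s → IsOdd n → IsOdd (n + 2 * s)
IsOdd-+2* s (j , refl) = j + s , cong suc (sym (*-distribˡ-+ 2 j s))

⊕-cong : ∀ {P P′ Q Q′ : Poly} → P ≗ P′ → Q ≗ Q′ → P ⊕ Q ≗ P′ ⊕ Q′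
⊕-cong P≗P′ Q≗Q′ k = cong₂ _xor_ (P≗P′ k) (Q≗Q′ k)

⊕-cancel-middle : ∀ (P Q R : Poly) → (P ⊕ Q) ⊕ (Q ⊕ R) ≗ P ⊕ R
⊕-cancel-middle P Q R k with P k | Q k | R k
... | false | false | _ = refl
... | false | true | false = refl
... | false | true | true = refl
... | true | false | _ = refl
... | true | true | false = refl
... | true | true | true = refl

shift-shift-⊕ : ∀ s t u P Q → shift s (shift t P ⊕ shift u Q) ≗ shift (s + t) P ⊕ shift (s + u) Q
shift-shift-⊕ s t u P Q k = trans (shift-⊕ s _ _ k) (cong₂ _xor_ (shift-shift s t P k) (shift-shift s u Q k))

Recurrence-double : ∀ {A r} → Recurrence A r → Recurrence A (2 * r)
Recurrence-double {A} {r} R n odd = begin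
  A (n + 8 * (2 * r))                                        ≡⟨ cong A (arith₁ n r) ⟩
  A (n₈ + 8 * r)                                             ≈⟨ R n₈ (subst IsOdd (arith₂ n r) (IsOdd-+2* (4 * r) odd)) ⟩
  shift (8 * r) (A n₈) ⊕ shift (2 * r) (A (n₈ + 2 * r))
    ≡⟨ cong (λ m → shift (8 * r) (A n₈) ⊕ shift (2 * r) (A m)) (arith₃ n r) ⟩
  shift (8 * r) (A n₈) ⊕ shift (2 * r) (A (n₂ + 8 * r))
    ≈⟨ ⊕-cong (shift-cong (8 * r) (R n odd)) (shift-cong (2 * r) (R n₂ (IsOdd-+2* r odd))) ⟩
  shift (8 * r) (shift (8 * r) (A n) ⊕ shift (2 * r) (A n₂)) ⊕ shift (2 * r) (shift (8 * r) (A n₂) ⊕ shift (2 * r) (A n₄))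
    ≈⟨ ⊕-cong (shift-shift-⊕ (8 * r) (8 * r) (2 * r) (A n) (A n₂)) (shift-shift-⊕ (2 * r) (8 * r) (2 * r) (A n₂) (A n₄)) ⟩
  (shift (8 * r + 8 * r) (A n) ⊕ shift (8 * r + 2 * r) (A n₂)) ⊕ (shift (2 * r + 8 * r) (A n₂) ⊕ shift (2 * r + 2 * r) (A n₄))
    ≡⟨ cong (λ s → (shift (8 * r + 8 * r) (A n) ⊕ shift (8 * r + 2 * r) (A n₂)) ⊕ (shift s (A n₂) ⊕ shift (2 * r + 2 * r) (A n₄)))
            (+-comm (2 * r) (8 * r)) ⟩
  (shift (8 * r + 8 * r) (A n) ⊕ shift (8 * r + 2 * r) (A n₂)) ⊕ (shift (8 * r + 2 * r) (A n₂) ⊕ shift (2 * r + 2 * r) (A n₄))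
    ≈⟨ ⊕-cancel-middle (shift (8 * r + 8 * r) (A n)) (shift (8 * r + 2 * r) (A n₂)) (shift (2 * r + 2 * r) (A n₄)) ⟩
  shift (8 * r + 8 * r) (A n) ⊕ shift (2 * r + 2 * r) (A n₄)
    ≡⟨ cong₂ (λ s t → shift s (A n) ⊕ shift t (A n₄)) (arith₄ r) (arith₅ r) ⟩
  shift (8 * (2 * r)) (A n) ⊕ shift (2 * (2 * r)) (A n₄)
    ≡⟨ cong (λ m → shift (8 * (2 * r)) (A n) ⊕ shift (2 * (2 * r)) (A m)) (arith₆ n r) ⟩
  shift (8 * (2 * r)) (A n) ⊕ shift (2 * (2 * r)) (A (n + 2 * (2 * r))) ∎
  where
  open import Relation.Binary.Reasoning.Setoid (ℕ →-setoid Bool)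
  n₂ = n + 2 * r
  n₄ = n₂ + 2 * r
  n₈ = n + 8 * r
  arith₁ : ∀ n r → n + 8 * (2 * r) ≡ n + 8 * r + 8 * r
  arith₁ = solve-∀
  arith₂ : ∀ n r → n + 2 * (4 * r) ≡ n + 8 * r
  arith₂ = solve-∀
  arith₃ : ∀ n r → n + 8 * r + 2 * r ≡ n + 2 * r + 8 * r
  arith₃ = solve-∀
  arith₄ : ∀ r → 8 * r + 8 * r ≡ 8 * (2 * r)
  arith₄ = solve-∀
  arith₅ : ∀ r → 2 * r + 2 * r ≡ 2 * (2 * r)
  arith₅ = solve-∀
  arith₆ : ∀ n r → n + 2 * r + 2 * r ≡ n + 2 * (2 * r)
  arith₆ = solve-∀

Recurrence-iterate : ∀ {A e} t → Recurrence A (2 ^ e) → Recurrence A (2 ^ (t + e))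
Recurrence-iterate zero R = R
Recurrence-iterate {A} {e} (suc t) R = Recurrence-double {A} {2 ^ (t + e)} (Recurrence-iterate {A} {e} t R)

Recurrence-mono : ∀ {A e j} → e ≤ j → Recurrence A (2 ^ e) → Recurrence A (2 ^ j)
Recurrence-mono {A} {e} {j} e≤j R = subst (λ i → Recurrence A (2 ^ i)) (m∸n+n≡m e≤j) (Recurrence-iterate (j ∸ e) R)

Recurrence-4^ : ∀ {A e h} → e ≤ h → Recurrence A (2 ^ e) → Recurrence A (4 ^ h)
Recurrence-4^ {A} {e} {h} e≤h R =
  subst (Recurrence A) (sym (^-*-assoc 2 2 h)) (Recurrence-mono (≤-trans e≤h (m≤m+n h (h + 0))) R)

bracket-odd : ∀ a b → IsOdd (bracket a b)
bracket-odd a b = ι a b , bracket≡ a b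

recurrence-at : ∀ {A r} X {a b am bm am′ bm′} → Recurrence A r → 4 * r ≡ X →
                ι a b ≡ ι am bm + X → ι am′ bm′ ≡ ι am bm + r →
                A (bracket a b) ≗ shift (2 * X) (A (bracket am bm)) ⊕ shift (2 * r) (A (bracket am′ bm′))
recurrence-at {A} {r} _ {a} {b} {am} {bm} {am′} {bm′} R refl e₁ e₂ =
  subst₂ (λ n m′ → A n ≗ shift (2 * (4 * r)) (A m) ⊕ shift (2 * r) (A m′))
    (trans (+-comm m (2 * (4 * r))) (sym (bracket-+ a b am bm (4 * r) e₁)))
    (trans (+-comm m (2 * r)) (sym (bracket-+ am′ bm′ am bm r e₂)))
    (subst (λ s → A (m + s) ≗ shift s (A m) ⊕ shift (2 * r) (A (m + 2 * r))) (8*≡2*4* r) (R m (bracket-odd am bm)))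
  where
  m = bracket am bm
  8*≡2*4* : ∀ r → 8 * r ≡ 2 * (4 * r)
  8*≡2*4* = solve-∀

CondBelow : (ℕ → Poly) → ℕ → Set
CondBelow A n = ∀ {c d} → bracket c d < n → Cond (A (bracket c d)) c d

cond-by-recurrence : ∀ {A r} X {a b am bm am′ bm′} → Recurrence A r → 4 * r ≡ X → 0 < r →
                     ι a b ≡ ι am bm + X → ι am′ bm′ ≡ ι am bm + r → CondBelow A (bracket a b) →
                     (Cond (A (bracket am bm)) am bm → Cond (A (bracket am′ bm′)) am′ bm′ →
                      Cond (shift (2 * X) (A (bracket am bm)) ⊕ shift (2 * r) (A (bracket am′ bm′))) a b) →
                     Cond (A (bracket a b)) a b
cond-by-recurrence {A} {r} X {a} {b} {am} {bm} {am′} {bm′} R 4r≡X r>0 e₁ e₂ IH combine =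
  Cond-≗ (recurrence-at {A} {r} X {a} {b} {am} {bm} {am′} {bm′} R 4r≡X e₁ e₂) (combine (IH {am} {bm} m<n) (IH {am′} {bm′} m′<n))
  where
  r<X : r < X
  r<X = subst (r <_) 4r≡X (m<m+n r (*-monoʳ-< 3 r>0))
  m<n : bracket am bm < bracket a b
  m<n = subst (bracket am bm <_) (sym (bracket-+ a b am bm X e₁)) (m<n+m _ (*-monoʳ-< 2 (<-trans r>0 r<X)))
  m′<n : bracket am′ bm′ < bracket a b
  m′<n = subst₂ _<_ (sym (bracket-+ am′ bm′ am bm r e₂)) (sym (bracket-+ a b am bm X e₁))
           (+-monoˡ-< (bracket am bm) (*-monoʳ-< 2 r<X))

-- Fix V = 2^h, W = 2V and a, b < 2W with max(a,b) ≥ W.  If b < W (the col cases) the recurrence with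
-- r = 4^h gives A_[a,b] = t^(8r) A_[a-W,b] + t^(2r) A_[c,d] where ι c d = ι (a-W) b + r; otherwise (the
-- row cases) r = 2·4^h and A_[a,b] = t^(8r) A_[a,b-W] + t^(2r) A_[c,d] where ι c d = ι a (b-W) + r.
-- The three cases of each kind are the three carry patterns of that addition.
module Scale (h : ℕ) where
  private
    V W : ℕ
    V = 2 ^ h
    W = 2 ^ suc h

    V>0 : 0 < V
    V>0 = 2^h>0 h

    <V⇒+V<W : ∀ {x} → x < V → x + V < W
    <V⇒+V<W {x} x<V = subst (x + V <_) (cong (V +_) (sym (+-identityʳ V))) (+-monoˡ-< V x<V)

    V<W : V < W
    V<W = <V⇒+V<W V>0

    ¬HasBit-+W : ∀ {x} → x < V → ¬ HasBit h (x + W)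
    ¬HasBit-+W {x} x<V = subst (λ y → ¬ HasBit h (x + y)) (*-comm V 2) (¬HasBit-even {h} 1 x<V)

    instance
      V≢0 : NonZero V
      V≢0 = m^n≢0 2 h

    pred-V<V : pred V < V
    pred-V<V = subst (pred V <_) (suc-pred V) (n<1+n (pred V))

  -- For α > 0 the lead [α-1+W,b] of the first term has no bit h, which a contribution of Q there would need;
  -- for α = 0 the lead [W-1,b] comes from Q's lead [V-1,b] instead, W-1 having no bit h+1.
  HasLead-colLow : ∀ {P Q α b} → α < V → Cond P α b → Cond Q (α + V) b →
                   HasLead (colShift (suc h) P ⊕ colShift h Q) (α + W) b
  HasLead-colLow {P} {Q} {zero} {b} _ (underP , _) (_ , leadQ) =
    HasLead-⊕ʳ {colShift (suc h) P} {colShift h Q} {W} {b} absentP leadQ′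
    where
    absentP : ∀ {a′} → W ≡ suc a′ → colShift (suc h) P (bracket a′ b) ≡ false
    absentP {a′} W≡ =
      absent-tightCol (suc h) underP (λ bit → <⇒≱ a′<W (HasBit⇒2^≤ {suc h} bit)) (trans (cong (_+ b) (sym W≡)) (+-comm W b))
      where
      a′<W : a′ < W
      a′<W = subst (a′ <_) (sym W≡) (n<1+n a′)
    leadQ′ : HasLead (colShift h Q) W b
    leadQ′ {a′} W≡ = shift-lead (4 ^ h) {a₀ = pred V} {b} a′ b (λ e → leadQ (trans (sym (suc-pred V)) e))
                       (trans (cong (λ x → ι x b) a′≡) (ι-setBitˡ h (pred V) b pred-V<V))
      where
      a′≡ : a′ ≡ pred V + V
      a′≡ = suc-injective (trans (sym W≡) (trans (cong (V +_) (+-identityʳ V)) (cong (_+ V) (sym (suc-pred V)))))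
  HasLead-colLow {P} {Q} {suc α₀} {b} α<V (_ , leadP) (underQ , _) =
    HasLead-⊕ˡ {colShift (suc h) P} {colShift h Q} {suc α₀ + W} {b}
      (HasLead-shiftCol (suc h) {P} {suc α₀} {b} (s≤s z≤n) (<-trans α<V V<W) leadP) absentQ
    where
    absentQ : ∀ {a′} → suc α₀ + W ≡ suc a′ → colShift h Q (bracket a′ b) ≡ false
    absentQ refl = absent-tightCol h underQ (¬HasBit-+W (<-trans (n<1+n α₀) α<V)) (tight α₀ b V)
      where
      tight : ∀ x y v → suc (x + 2 * v + y) ≡ suc x + v + y + v
      tight = solve-∀

  Cond-colLow : ∀ {P Q α b} → α < V → Cond P α b → Cond Q (α + V) b → Cond (colShift (suc h) P ⊕ colShift h Q) (α + W) b
  Cond-colLow {P} {Q} {α} {b} α<V condP@(underP , _) condQ@(underQ , _) =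
    AllUnder-⊕ (AllUnder-mono (≡⇒≤ₗ (cong (_, b) (xy∙z≈xz∙y α b W))) (AllUnder-shiftCol (suc h) underP))
               (AllUnder-mono (≡⇒≤ₗ (cong (_, b) (double α b V))) (AllUnder-shiftCol h underQ)) ,
    HasLead-colLow α<V condP condQ
    where
    double : ∀ x y v → x + v + y + v ≡ x + 2 * v + y
    double = solve-∀

  Cond-colMid : ∀ {P Q α′ b} → α′ < V → Cond P (α′ + V) b → Cond Q α′ (b + V) →
                Cond (colShift (suc h) P ⊕ colShift h Q) (α′ + V + W) b
  Cond-colMid {P} {Q} {α′} {b} α′<V (underP , leadP) (underQ , _) =
    AllUnder-⊕ (AllUnder-mono (≡⇒≤ₗ (cong (_, b) (xy∙z≈xz∙y (α′ + V) b W))) (AllUnder-shiftCol (suc h) underP))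
               (AllUnder-mono (<ₗ⇒≤ₗ below) underQ′) ,
    HasLead-⊕ˡ {colShift (suc h) P} {colShift h Q} {α′ + V + W} {b}
      (HasLead-shiftCol (suc h) {P} {α′ + V} {b} (<-≤-trans V>0 (m≤n+m V α′)) (<V⇒+V<W α′<V) leadP)
      (absent-below underQ′ below)
    where
    underQ′ : AllUnder (colShift h Q) (α′ + (b + V) + V , b + V)
    underQ′ = AllUnder-shiftCol h underQ
    below : (α′ + (b + V) + V , b + V) <ₗ (α′ + V + W + b , b)
    below = inj₁ (<-by V V>0 (arith α′ b V))
      where
      arith : ∀ x y v → x + (y + v) + v + v ≡ x + v + 2 * v + y
      arith = solve-∀

  Cond-colHigh : ∀ {P Q α′ b′} → α′ < V → Cond P (α′ + V) (b′ + V) → Cond Q (α′ + W) b′ →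
                 Cond (colShift (suc h) P ⊕ colShift h Q) (α′ + V + W) (b′ + V)
  Cond-colHigh {P} {Q} {α′} {b′} α′<V (underP , leadP) (underQ , _) =
    AllUnder-⊕ (AllUnder-mono (≡⇒≤ₗ (cong (_, b′ + V) (xy∙z≈xz∙y (α′ + V) (b′ + V) W))) (AllUnder-shiftCol (suc h) underP))
               (AllUnder-mono (<ₗ⇒≤ₗ below) underQ′) ,
    HasLead-⊕ˡ {colShift (suc h) P} {colShift h Q} {α′ + V + W} {b′ + V}
      (HasLead-shiftCol (suc h) {P} {α′ + V} {b′ + V} (<-≤-trans V>0 (m≤n+m V α′)) (<V⇒+V<W α′<V) leadP)
      (absent-below underQ′ below)
    where
    underQ′ : AllUnder (colShift h Q) (α′ + W + b′ + V , b′)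
    underQ′ = AllUnder-shiftCol h underQ
    below : (α′ + W + b′ + V , b′) <ₗ (α′ + V + W + (b′ + V) , b′ + V)
    below = inj₁ (<-by V V>0 (arith α′ b′ V))
      where
      arith : ∀ x y v → x + 2 * v + y + v + v ≡ x + v + 2 * v + (y + v)
      arith = solve-∀

  Cond-rowLow : ∀ {P Q a β} → β < V → Cond P a β → Cond Q a (β + V) →
                Cond (rowShift (suc h) P ⊕ rowShift h Q) a (β + W)
  Cond-rowLow {P} {Q} {a} {β} β<V (underP , leadP) (underQ , _) =
    AllUnder-⊕ (AllUnder-mono (≡⇒≤ₗ (cong (_, β + W) (+-assoc a β W))) (AllUnder-shiftRow (suc h) underP))
               (AllUnder-mono (≡⇒≤ₗ (cong₂ _,_ (arith₁ a β V) (arith₂ β V))) underQ′) ,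
    HasLead-⊕ˡ {rowShift (suc h) P} {rowShift h Q} {a} {β + W}
      (HasLead-shiftRow (suc h) {P} {a} {β} (<-trans β<V V<W) leadP) absentQ
    where
    arith₁ : ∀ x y v → x + (y + v) + v ≡ x + (y + 2 * v)
    arith₁ = solve-∀
    arith₂ : ∀ y v → y + v + v ≡ y + 2 * v
    arith₂ = solve-∀
    underQ′ : AllUnder (rowShift h Q) (a + (β + V) + V , β + V + V)
    underQ′ = AllUnder-shiftRow h underQ
    -- [a-1,β+W] has no bit h in its second coordinate, which Q's contributions at that key would need.
    absentQ : ∀ {a′} → a ≡ suc a′ → rowShift h Q (bracket a′ (β + W)) ≡ false
    absentQ {a′} refl = absent-tightRow h {x = a′} underQ (¬HasBit-+W β<V) (tight a′ β V) (+-monoʳ-< β V<W)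
      where
      tight : ∀ x y v → suc (x + (y + 2 * v)) ≡ suc x + (y + v) + v
      tight = solve-∀

  Cond-rowMid : ∀ {P Q a β′} → β′ < V → Cond P a (β′ + V) → Cond Q (a + W) β′ →
                Cond (rowShift (suc h) P ⊕ rowShift h Q) a (β′ + V + W)
  Cond-rowMid {P} {Q} {a} {β′} β′<V (underP , leadP) (underQ , _) =
    AllUnder-⊕ (AllUnder-mono (≡⇒≤ₗ (cong (_, β′ + V + W) (+-assoc a (β′ + V) W))) (AllUnder-shiftRow (suc h) underP))
               (AllUnder-mono (<ₗ⇒≤ₗ below) underQ′) ,
    HasLead-⊕ˡ {rowShift (suc h) P} {rowShift h Q} {a} {β′ + V + W}
      (HasLead-shiftRow (suc h) {P} {a} {β′ + V} (<V⇒+V<W β′<V) leadP) (absent-below underQ′ below)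
    where
    underQ′ : AllUnder (rowShift h Q) (a + W + β′ + V , β′ + V)
    underQ′ = AllUnder-shiftRow h underQ
    below : (a + W + β′ + V , β′ + V) <ₗ (a + (β′ + V + W) , β′ + V + W)
    below = inj₂ (arith a β′ V , m<m+n (β′ + V) (<-trans V>0 V<W))
      where
      arith : ∀ x y v → x + 2 * v + y + v ≡ x + (y + v + 2 * v)
      arith = solve-∀

  Cond-rowHigh : ∀ {P Q a″ β′} → β′ < V → Cond P (a″ + W) (β′ + V) → Cond Q a″ (β′ + W) →
                 Cond (rowShift (suc h) P ⊕ rowShift h Q) (a″ + W) (β′ + V + W)
  Cond-rowHigh {P} {Q} {a″} {β′} β′<V (underP , leadP) (underQ , _) =
    AllUnder-⊕ (AllUnder-mono (≡⇒≤ₗ (cong (_, β′ + V + W) (+-assoc (a″ + W) (β′ + V) W))) (AllUnder-shiftRow (suc h) underP))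
               (AllUnder-mono (<ₗ⇒≤ₗ below) underQ′) ,
    HasLead-⊕ˡ {rowShift (suc h) P} {rowShift h Q} {a″ + W} {β′ + V + W}
      (HasLead-shiftRow (suc h) {P} {a″ + W} {β′ + V} (<V⇒+V<W β′<V) leadP) (absent-below underQ′ below)
    where
    underQ′ : AllUnder (rowShift h Q) (a″ + (β′ + W) + V , β′ + W + V)
    underQ′ = AllUnder-shiftRow h underQ
    below : (a″ + (β′ + W) + V , β′ + W + V) <ₗ (a″ + W + (β′ + V + W) , β′ + V + W)
    below = inj₁ (<-by W (<-trans V>0 V<W) (arith a″ β′ V))
      where
      arith : ∀ x y v → x + (y + 2 * v) + v + 2 * v ≡ x + 2 * v + (y + v + 2 * v)
      arith = solve-∀

  module Steps {A : ℕ → Poly} (R : Recurrence A (4 ^ h)) where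
    private
      4^h>0 : 0 < 4 ^ h
      4^h>0 = m^n>0 4 h

      col-step : ∀ {a b am bm am′ bm′} → ι a b ≡ ι am bm + 4 ^ suc h → ι am′ bm′ ≡ ι am bm + 4 ^ h →
                 CondBelow A (bracket a b) →
                 (Cond (A (bracket am bm)) am bm → Cond (A (bracket am′ bm′)) am′ bm′ →
                  Cond (colShift (suc h) (A (bracket am bm)) ⊕ colShift h (A (bracket am′ bm′))) a b) →
                 Cond (A (bracket a b)) a b
      col-step {a} {b} {am} {bm} {am′} {bm′} =
        cond-by-recurrence {A} {4 ^ h} (4 ^ suc h) {a} {b} {am} {bm} {am′} {bm′} R refl 4^h>0

      row-step : ∀ {a b am bm am′ bm′} → ι a b ≡ ι am bm + 2 * 4 ^ suc h → ι am′ bm′ ≡ ι am bm + 2 * 4 ^ h →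
                 CondBelow A (bracket a b) →
                 (Cond (A (bracket am bm)) am bm → Cond (A (bracket am′ bm′)) am′ bm′ →
                  Cond (rowShift (suc h) (A (bracket am bm)) ⊕ rowShift h (A (bracket am′ bm′))) a b) →
                 Cond (A (bracket a b)) a b
      row-step {a} {b} {am} {bm} {am′} {bm′} =
        cond-by-recurrence {A} {2 * 4 ^ h} (2 * 4 ^ suc h) {a} {b} {am} {bm} {am′} {bm′}
          (Recurrence-double {A} {4 ^ h} R) (swap4 (4 ^ h)) (*-monoʳ-< 2 4^h>0)
        where
        swap4 : ∀ q → 4 * (2 * q) ≡ 2 * (4 * q)
        swap4 = solve-∀

      2q≡q+q : ∀ x q → x + 2 * q ≡ x + q + q
      2q≡q+q = solve-∀

      4q≡2q+q+q : ∀ x q → x + 4 * q ≡ x + 2 * q + q + q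
      4q≡2q+q+q = solve-∀

      4q≡2q+2q : ∀ x q → x + 4 * q ≡ x + 2 * q + 2 * q
      4q≡2q+2q = solve-∀

      8q≡2q+4q+2q : ∀ x q → x + 2 * (4 * q) ≡ x + 2 * q + 4 * q + 2 * q
      8q≡2q+4q+2q = solve-∀

    cond-colLow : ∀ {α b} → α < V → CondBelow A (bracket (α + W) b) → Cond (A (bracket (α + W) b)) (α + W) b
    cond-colLow {α} {b} α<V IH =
      col-step {α + W} {b} {α} {b} {α + V} {b}
        (ι-setBitˡ (suc h) α b (<-trans α<V V<W)) (ι-setBitˡ h α b α<V) IH (Cond-colLow α<V)

    cond-colMid : ∀ {α′ b} → α′ < V → b < V → CondBelow A (bracket (α′ + V + W) b) →
                  Cond (A (bracket (α′ + V + W) b)) (α′ + V + W) b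
    cond-colMid {α′} {b} α′<V b<V IH =
      col-step {α′ + V + W} {b} {α′ + V} {b} {α′} {b + V}
        (ι-setBitˡ (suc h) (α′ + V) b (<V⇒+V<W α′<V)) carry IH (Cond-colMid α′<V)
      where
      carry : ι α′ (b + V) ≡ ι (α′ + V) b + 4 ^ h
      carry = begin
        ι α′ (b + V)                ≡⟨ ι-setBitʳ h α′ b b<V ⟩
        ι α′ b + 2 * 4 ^ h          ≡⟨ 2q≡q+q (ι α′ b) (4 ^ h) ⟩
        ι α′ b + 4 ^ h + 4 ^ h      ≡⟨ cong (_+ 4 ^ h) (sym (ι-setBitˡ h α′ b α′<V)) ⟩
        ι (α′ + V) b + 4 ^ h        ∎
        where open ≡-Reasoning

    cond-colHigh : ∀ {α′ b′} → α′ < V → b′ < V → CondBelow A (bracket (α′ + V + W) (b′ + V)) →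
                   Cond (A (bracket (α′ + V + W) (b′ + V))) (α′ + V + W) (b′ + V)
    cond-colHigh {α′} {b′} α′<V b′<V IH =
      col-step {α′ + V + W} {b′ + V} {α′ + V} {b′ + V} {α′ + W} {b′}
        (ι-setBitˡ (suc h) (α′ + V) (b′ + V) (<V⇒+V<W α′<V)) carry IH (Cond-colHigh α′<V)
      where
      carry : ι (α′ + W) b′ ≡ ι (α′ + V) (b′ + V) + 4 ^ h
      carry = begin
        ι (α′ + W) b′                        ≡⟨ ι-setBitˡ (suc h) α′ b′ (<-trans α′<V V<W) ⟩
        ι α′ b′ + 4 * 4 ^ h                  ≡⟨ 4q≡2q+q+q (ι α′ b′) (4 ^ h) ⟩
        ι α′ b′ + 2 * 4 ^ h + 4 ^ h + 4 ^ h  ≡⟨ cong (λ x → x + 4 ^ h + 4 ^ h) (sym (ι-setBitʳ h α′ b′ b′<V)) ⟩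
        ι α′ (b′ + V) + 4 ^ h + 4 ^ h        ≡⟨ cong (_+ 4 ^ h) (sym (ι-setBitˡ h α′ (b′ + V) α′<V)) ⟩
        ι (α′ + V) (b′ + V) + 4 ^ h          ∎
        where open ≡-Reasoning

    cond-rowLow : ∀ {a β} → β < V → CondBelow A (bracket a (β + W)) → Cond (A (bracket a (β + W))) a (β + W)
    cond-rowLow {a} {β} β<V IH =
      row-step {a} {β + W} {a} {β} {a} {β + V}
        (ι-setBitʳ (suc h) a β (<-trans β<V V<W)) (ι-setBitʳ h a β β<V) IH (Cond-rowLow β<V)

    cond-rowMid : ∀ {a β′} → a < W → β′ < V → CondBelow A (bracket a (β′ + V + W)) →
                  Cond (A (bracket a (β′ + V + W))) a (β′ + V + W)
    cond-rowMid {a} {β′} a<W β′<V IH =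
      row-step {a} {β′ + V + W} {a} {β′ + V} {a + W} {β′}
        (ι-setBitʳ (suc h) a (β′ + V) (<V⇒+V<W β′<V)) carry IH (Cond-rowMid β′<V)
      where
      carry : ι (a + W) β′ ≡ ι a (β′ + V) + 2 * 4 ^ h
      carry = begin
        ι (a + W) β′                       ≡⟨ ι-setBitˡ (suc h) a β′ a<W ⟩
        ι a β′ + 4 * 4 ^ h                 ≡⟨ 4q≡2q+2q (ι a β′) (4 ^ h) ⟩
        ι a β′ + 2 * 4 ^ h + 2 * 4 ^ h     ≡⟨ cong (_+ 2 * 4 ^ h) (sym (ι-setBitʳ h a β′ β′<V)) ⟩
        ι a (β′ + V) + 2 * 4 ^ h           ∎
        where open ≡-Reasoning

    cond-rowHigh : ∀ {a″ β′} → a″ < W → β′ < V → CondBelow A (bracket (a″ + W) (β′ + V + W)) →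
                   Cond (A (bracket (a″ + W) (β′ + V + W))) (a″ + W) (β′ + V + W)
    cond-rowHigh {a″} {β′} a″<W β′<V IH =
      row-step {a″ + W} {β′ + V + W} {a″ + W} {β′ + V} {a″} {β′ + W}
        (ι-setBitʳ (suc h) (a″ + W) (β′ + V) (<V⇒+V<W β′<V)) carry IH (Cond-rowHigh β′<V)
      where
      carry : ι a″ (β′ + W) ≡ ι (a″ + W) (β′ + V) + 2 * 4 ^ h
      carry = begin
        ι a″ (β′ + W)                                ≡⟨ ι-setBitʳ (suc h) a″ β′ (<-trans β′<V V<W) ⟩
        ι a″ β′ + 2 * (4 * 4 ^ h)                    ≡⟨ 8q≡2q+4q+2q (ι a″ β′) (4 ^ h) ⟩
        ι a″ β′ + 2 * 4 ^ h + 4 * 4 ^ h + 2 * 4 ^ h  ≡⟨ cong (λ x → x + 4 * 4 ^ h + 2 * 4 ^ h) (sym (ι-setBitʳ h a″ β′ β′<V)) ⟩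
        ι a″ (β′ + V) + 4 * 4 ^ h + 2 * 4 ^ h        ≡⟨ cong (_+ 2 * 4 ^ h) (sym (ι-setBitˡ (suc h) a″ (β′ + V) a″<W)) ⟩
        ι (a″ + W) (β′ + V) + 2 * 4 ^ h              ∎
        where open ≡-Reasoning

    cond-large : ∀ {a b} → a < 2 * W → b < 2 * W → W ≤ a ⊎ W ≤ b → CondBelow A (bracket a b) → Cond (A (bracket a b)) a b
    cond-large a<2W b<2W W≤ab IH with split-at W b<2W
    cond-large a<2W b<2W W≤ab IH | inj₁ b<W with split-at W a<2W
    ... | inj₁ a<W = ⊥-elim (≤⊎≤⇒¬<×< W≤ab a<W b<W)
    ... | inj₂ (α , α<W , refl) with split-at V α<W
    ...   | inj₁ α<V = cond-colLow α<V IH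
    ...   | inj₂ (α′ , α′<V , refl) with split-at V b<W
    ...     | inj₁ b<V = cond-colMid α′<V b<V IH
    ...     | inj₂ (b′ , b′<V , refl) = cond-colHigh α′<V b′<V IH
    cond-large a<2W b<2W W≤ab IH | inj₂ (β , β<W , refl) with split-at V β<W
    ... | inj₁ β<V = cond-rowLow β<V IH
    ... | inj₂ (β′ , β′<V , refl) with split-at W a<2W
    ...   | inj₁ a<W = cond-rowMid a<W β′<V IH
    ...   | inj₂ (a″ , a″<W , refl) = cond-rowHigh a″<W β′<V IH

-- The induction

binary-magnitude : ∀ {M} → 0 < M → ∃ λ k → 2 ^ k ≤ M × M < 2 ^ suc k
binary-magnitude {suc zero} _ = 0 , ≤-refl , s≤s (s≤s z≤n)
binary-magnitude {suc (suc n)} _ with binary-magnitude {suc n} (s≤s z≤n)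
... | k , lo , hi with suc (suc n) <? 2 ^ suc k
...   | yes hi′ = k , m≤n⇒m≤1+n lo , hi′
...   | no ¬hi′ = suc k , ≤-reflexive (sym M≡) , subst (_< 2 ^ suc (suc k)) (sym M≡) (^-monoʳ-< 2 (s≤s (s≤s z≤n)) (n<1+n (suc k)))
  where
  M≡ : suc (suc n) ≡ 2 ^ suc k
  M≡ = ≤-antisym hi (≮⇒≥ ¬hi′)

scale : ∀ e {a b} → 2 ^ suc e ≤ a ⊔ b →
        ∃ λ h → e ≤ h × a < 2 * 2 ^ suc h × b < 2 * 2 ^ suc h × (2 ^ suc h ≤ a ⊎ 2 ^ suc h ≤ b)
scale e {a} {b} big with binary-magnitude (<-≤-trans (2^h>0 (suc e)) big)
... | zero , _ , M<2 = ⊥-elim (<⇒≱ M<2 (≤-trans (^-monoʳ-≤ 2 (s≤s (z≤n {e}))) big))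
... | suc h , lo , hi with e ≤? h
...   | no e≰h = ⊥-elim (<⇒≱ hi (≤-trans (^-monoʳ-≤ 2 (s≤s (≰⇒> e≰h))) big))
...   | yes e≤h = h , e≤h , ≤-<-trans (m≤m⊔n a b) hi , ≤-<-trans (m≤n⊔m a b) hi , top (⊔-sel a b)
  where
  top : a ⊔ b ≡ a ⊎ a ⊔ b ≡ b → 2 ^ suc h ≤ a ⊎ 2 ^ suc h ≤ b
  top (inj₁ M≡a) = inj₁ (subst (2 ^ suc h ≤_) M≡a lo)
  top (inj₂ M≡b) = inj₂ (subst (2 ^ suc h ≤_) M≡b lo)

4^≡2^*2^ : ∀ e → 4 ^ e ≡ 2 ^ e * 2 ^ e
4^≡2^*2^ zero = refl
4^≡2^*2^ (suc e) = trans (cong (4 *_) (4^≡2^*2^ e)) (square-double (2 ^ e))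
  where
  square-double : ∀ x → 4 * (x * x) ≡ 2 * x * (2 * x)
  square-double = solve-∀

bracket-< : ∀ e {a b} → a < 2 ^ suc e → b < 2 ^ suc e → bracket a b < 8 * (2 ^ e * 2 ^ e)
bracket-< e {a} {b} a< b< = begin-strict
  bracket a b              ≡⟨ bracket≡ a b ⟩
  suc (2 * ι a b)          <⟨ ≤-reflexive (sym (*-suc 2 (ι a b))) ⟩
  2 * suc (ι a b)          ≤⟨ *-monoʳ-≤ 2 (ι-< (suc e) a< b<) ⟩
  2 * (4 * 4 ^ e)          ≡⟨ cong (λ x → 2 * (4 * x)) (4^≡2^*2^ e) ⟩
  2 * (4 * (2 ^ e * 2 ^ e)) ≡⟨ sym (*-assoc 2 4 (2 ^ e * 2 ^ e)) ⟩
  8 * (2 ^ e * 2 ^ e)      ∎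
  where open ≤-Reasoning

cond-all : ∀ {A e} → Recurrence A (2 ^ e) → (∀ n → IsOdd n → n < 8 * (2 ^ e * 2 ^ e) → Sat1α A n) →
           ∀ a b → Cond (A (bracket a b)) a b
cond-all {A} {e} R base a b = <-rec Motive step (bracket a b) a b refl
  where
  Motive : ℕ → Set
  Motive n = ∀ a b → bracket a b ≡ n → Cond (A (bracket a b)) a b
  step : ∀ n → (∀ {m} → m < n → Motive m) → Motive n
  step _ IH a b refl with a ⊔ b <? 2 ^ suc e
  ... | yes small = Cond1α⇒Cond (A (bracket a b)) a b
        (base (bracket a b) (bracket-odd a b) (bracket-< e (m⊔n<o⇒m<o a b small) (m⊔n<o⇒n<o a b small)) a b refl)
  ... | no large with scale e (≮⇒≥ large)
  ...   | h , e≤h , a< , b< , top = Scale.Steps.cond-large h (Recurrence-4^ e≤h R) a< b< top (λ lt → IH lt _ _ refl)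

theorem3p7 : (e : ℕ) → (A : ℕ → Poly) →
    (∀ n → IsOdd n → InTZ2T2 (A n)) →
    (∀ n → IsOdd n → ∀ m →
      A (n + 8 * 2 ^ e) m ≡ (shift (8 * 2 ^ e) (A n) ⊕ shift (2 * 2 ^ e) (A (n + 2 * 2 ^ e))) m) →
    (∀ n → IsOdd n → n < 8 * (2 ^ e * 2 ^ e) → Sat1α A n) →
    ∀ n → IsOdd n → Sat1α A n
theorem3p7 e A _ recurrence base n _ a b refl = Cond⇒Cond1α (A (bracket a b)) a b (cond-all {A} {e} recurrence base a b)
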